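{- $d_0(C_8)=\Gamma_t(C_8)+2$, and for every $n\geq 3$ with $n\neq 8$, $d_0(C_n)=\Gamma_t(C_n)+1$.
   Context: $C_n$ is the cycle on $n$ vertices. A total dominating set (TDS) of a graph without isolated vertices is a vertex set $S$ such that every vertex is adjacent to a vertex of $S$; a minimal TDS is a TDS no proper subset of which is a TDS; $\Gamma_t(G)$ is the maximum cardinality of a minimal TDS. For a positive integer $k$, $D_k^t(G)$ is the graph whose vertices are the TDSs of $G$ of cardinality at most $k$, two being adjacent if and only if one is obtained from the other by adding or deleting a single vertex. $d_0(G)$ is the smallest integer $\ell$ such that $D_k^t(G)$ is connected for all $k\geq\ell$. -}

module Defs where

open import Data.Nat using (ℕ; zero; suc; _+_; _≤_; _<_)
open import Data.Fin using (Fin; toℕ)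
open import Data.Fin.Subset using (Subset; _∈_; _∉_; _⊂_; _∪_; ⁅_⁆; ∣_∣)
open import Data.Product using (Σ; _×_; ∃-syntax)
open import Data.Sum using (_⊎_)
open import Relation.Binary.PropositionalEquality using (_≡_)
open import Relation.Nullary using (¬_)

-- Adjacency in the cycle C_n on vertex set Fin n (vertices 0,1,...,n-1,
-- i adjacent to i+1, and n-1 adjacent to 0). Intended for n ≥ 3.
CycleAdj : (n : ℕ) → Fin n → Fin n → Set
CycleAdj n u v =
  (suc (toℕ u) ≡ toℕ v) ⊎ (suc (toℕ v) ≡ toℕ u)
  ⊎ ((toℕ u ≡ 0 × suc (toℕ v) ≡ n) ⊎ (toℕ v ≡ 0 × suc (toℕ u) ≡ n))

IsTDS : (n : ℕ) → Subset n → Set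
IsTDS n S = ∀ (v : Fin n) → ∃[ u ] (u ∈ S × CycleAdj n v u)

IsMinimalTDS : (n : ℕ) → Subset n → Set
IsMinimalTDS n S = IsTDS n S × (∀ (T : Subset n) → T ⊂ S → ¬ IsTDS n T)

IsUpperTotalDomination : (n : ℕ) → ℕ → Set
IsUpperTotalDomination n g =
  (∃[ S ] (IsMinimalTDS n S × ∣ S ∣ ≡ g))
  × (∀ (S : Subset n) → IsMinimalTDS n S → ∣ S ∣ ≤ g)

IsDVertex : (n k : ℕ) → Subset n → Set
IsDVertex n k S = IsTDS n S × ∣ S ∣ ≤ k

DEdge : (n : ℕ) → Subset n → Subset n → Set
DEdge n S T =
  (∃[ v ] (v ∉ S × T ≡ S ∪ ⁅ v ⁆)) ⊎ (∃[ v ] (v ∉ T × S ≡ T ∪ ⁅ v ⁆))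

data Reach (n k : ℕ) (S : Subset n) : Subset n → Set where
  here : Reach n k S S
  step : ∀ {T U} → Reach n k S T → IsDVertex n k U → DEdge n T U → Reach n k S U

DConnected : (n k : ℕ) → Set
DConnected n k =
  ∀ (S T : Subset n) → IsDVertex n k S → IsDVertex n k T → Reach n k S T

ConnectedFrom : (n ℓ : ℕ) → Set
ConnectedFrom n ℓ = ∀ (k : ℕ) → 1 ≤ k → ℓ ≤ k → DConnected n k

IsD0 : (n : ℕ) → ℕ → Set
IsD0 n d = ConnectedFrom n d × (∀ (m : ℕ) → ConnectedFrom n m → d ≤ m)

module Submission where

-- Vertex i+1 is
-- dominated exactly by i and i+2, so a TDS is the same as a cover of all
-- "two-step pairs" {i, i+2}; the two-step graph is one cycle (n odd) or two
-- cycles of length n/2 (n even).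
--
-- Lower bound: a minimal TDS of maximum size Γ_t is an isolated vertex of
-- D_{Γ_t}^t, which has other vertices, so d_0 ≥ Γ_t + 1.  For C_8 a brute
-- force invariant also disconnects D_5^t = D_{Γ_t+1}^t.
--
-- Upper bound: with one unit of spare budget every TDS walks to a minimal
-- TDS (deletions) and then, by deletions and slides (insert one vertex,
-- delete another), to a unique canonical cover: first a chosen vertex of
-- each two-step cycle is evicted, then each cycle is swept into a fixed
-- alternating pattern.  Eviction is hard only when the cover alternates
-- along the whole cycle, which happens for n ≡ 0 mod 4; for n ≥ 12 the
-- intermediate cover built there is again minimal, for n = 8 it costs an
-- extra unit, which is why C_8 is exceptional.

open import Defs
open import Data.Nat using (ℕ; suc; _+_; _*_; _≤_)
open import Data.Product using (_×_; ∃-syntax)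
open import Relation.Binary.PropositionalEquality using (_≡_; _≢_)

module SubsetFacts where

  open import Data.Nat using (ℕ; suc)
  open import Data.Fin using (Fin; zero; suc; _≟_)
  open import Data.Fin.Subset
  open import Data.Fin.Subset.Properties
  open import Data.Vec using (_∷_)
  open import Data.Product using (_×_; _,_; proj₁; proj₂)
  open import Data.Sum using (_⊎_; inj₁; inj₂)
  open import Data.Empty using (⊥-elim)
  open import Relation.Nullary using (yes; no)
  open import Relation.Binary.PropositionalEquality

  open Data.Vec using (here; there)

  private variable m : ℕ

  ∈∪⁅⁆-inv : ∀ {x y : Fin m} (p : Subset m) → x ∈ p ∪ ⁅ y ⁆ → x ∈ p ⊎ x ≡ y
  ∈∪⁅⁆-inv {y = y} p h with x∈p∪q⁻ p ⁅ y ⁆ h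
  ... | inj₁ x∈p = inj₁ x∈p
  ... | inj₂ x∈y = inj₂ (x∈⁅y⁆⇒x≡y y x∈y)

  ∈∪⁅⁆-l : ∀ {x y : Fin m} (p : Subset m) → x ∈ p → x ∈ p ∪ ⁅ y ⁆
  ∈∪⁅⁆-l p h = x∈p∪q⁺ (inj₁ h)

  ∈∪⁅⁆-r : ∀ (y : Fin m) (p : Subset m) → y ∈ p ∪ ⁅ y ⁆
  ∈∪⁅⁆-r y p = x∈p∪q⁺ {p = p} (inj₂ (x∈⁅x⁆ y))

  ∈-del-inv : ∀ {x : Fin m} (p : Subset m) (y : Fin m) → x ∈ p - y → x ∈ p × x ≢ y
  ∈-del-inv {x = zero} (s ∷ p) zero ()
  ∈-del-inv {x = zero} (inside ∷ p) (suc y) here = here , λ ()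
  ∈-del-inv {x = suc x} (s ∷ p) zero (there h) = there (p─q⊆p p ⊥ h) , λ ()
  ∈-del-inv {x = suc x} (s ∷ p) (suc y) (there h) with ∈-del-inv p y h
  ... | x∈p , x≢y = there x∈p , λ { refl → x≢y refl }

  ∉-del-self : ∀ (p : Subset m) (y : Fin m) → y ∉ p - y
  ∉-del-self p y h = proj₂ (∈-del-inv p y h) refl

  size-add : ∀ (p : Subset m) (x : Fin m) → x ∉ p → ∣ p ∪ ⁅ x ⁆ ∣ ≡ suc ∣ p ∣
  size-add (outside ∷ p) zero h = cong suc (cong ∣_∣ (∪-identityʳ p))
  size-add (inside ∷ p) zero h = ⊥-elim (h here)
  size-add (outside ∷ p) (suc x) h = size-add p x (λ z → h (there z))
  size-add (inside ∷ p) (suc x) h = cong suc (size-add p x (λ z → h (there z)))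

  size-del : ∀ (p : Subset m) (x : Fin m) → x ∈ p → suc ∣ p - x ∣ ≡ ∣ p ∣
  size-del (inside ∷ p) zero here = cong suc (cong ∣_∣ (p─⊥≡p p))
  size-del (outside ∷ p) (suc x) (there h) = size-del p x h
  size-del (inside ∷ p) (suc x) (there h) = cong suc (size-del p x h)

  del-add : ∀ (p : Subset m) (x : Fin m) → x ∈ p → (p - x) ∪ ⁅ x ⁆ ≡ p
  del-add p x x∈p = ⊆-antisym shrink grow
    where
    shrink : (p - x) ∪ ⁅ x ⁆ ⊆ p
    shrink q with ∈∪⁅⁆-inv (p - x) q
    ... | inj₁ z∈p-x = proj₁ (∈-del-inv p x z∈p-x)
    ... | inj₂ refl = x∈p
    grow : p ⊆ (p - x) ∪ ⁅ x ⁆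
    grow {z} q with z ≟ x
    ... | yes refl = ∈∪⁅⁆-r x (p - x)
    ... | no z≢x = ∈∪⁅⁆-l (p - x) (x∈p∧x≢y⇒x∈p-y q z≢x)

module Walks where

  open import Data.Sum using (inj₁; inj₂)

  module _ {n k : ℕ} where

    trans-R : ∀ {S T U} → Reach n k S T → Reach n k T U → Reach n k S U
    trans-R r here = r
    trans-R r (step r' d e) = step (trans-R r r') d e

    edge-sym : ∀ {S T} → DEdge n S T → DEdge n T S
    edge-sym (inj₁ x) = inj₂ x
    edge-sym (inj₂ y) = inj₁ y

    one : ∀ {S T} → IsDVertex n k T → DEdge n S T → Reach n k S T
    one d e = step here d e

    endV : ∀ {S U} → Reach n k S U → IsDVertex n k S → IsDVertex n k U
    endV here d = d
    endV (step r d e) _ = d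

    rev-R : ∀ {S T} → IsDVertex n k S → Reach n k S T → Reach n k T S
    rev-R dS here = here
    rev-R dS (step r dT e) = trans-R (one (endV r dS) (edge-sym e)) (rev-R dS r)

-- Working with ℕ-indices modulo n lets the later
-- arguments walk around the cycle freely, without case splits at the wrap.
module CyclePositions (n₀ : ℕ) where

  open import Data.Nat using (suc; _+_; _*_; _∸_; _<_; s≤s; _%_; _/_)
  open import Data.Nat.Properties
  open import Data.Nat.DivMod
  open import Data.Nat.Divisibility using (_∣_; divides; ∣⇒≤)
  open import Data.Fin using (Fin; toℕ; fromℕ<)
  open import Data.Fin.Properties using (toℕ-fromℕ<; toℕ-injective; toℕ<n)
  open import Data.Fin.Subset
  open import Data.Fin.Subset.Properties using (_∈?_; x∈p∧x≢y⇒x∈p-y)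
  open import Data.Product using (_×_; _,_; proj₁; proj₂)
  open import Data.Sum using (_⊎_; inj₁; inj₂)
  open import Relation.Nullary using (¬_; yes; no; Dec)
  open import Relation.Binary.PropositionalEquality
  open SubsetFacts

  n : ℕ
  n = suc (suc (suc n₀))

  opaque
    pos : ℕ → Fin n
    pos i = fromℕ< (m%n<n i n)

    toℕ-pos : ∀ i → toℕ (pos i) ≡ i % n
    toℕ-pos i = toℕ-fromℕ< (m%n<n i n)

  infix 4 _≈_
  record _≈_ (i j : ℕ) : Set where
    constructor mk≈
    field un≈ : i % n ≡ j % n
  open _≈_ public

  pos-≈ : ∀ {i j} → i ≈ j → pos i ≡ pos j
  pos-≈ {i} {j} (mk≈ e) = toℕ-injective (trans (toℕ-pos i) (trans e (sym (toℕ-pos j))))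

  ≈-pos : ∀ {i j} → pos i ≡ pos j → i ≈ j
  ≈-pos {i} {j} e = mk≈ (trans (sym (toℕ-pos i)) (trans (cong toℕ e) (toℕ-pos j)))

  ≈-refl : ∀ {i} → i ≈ i
  ≈-refl = mk≈ refl

  ≈-sym : ∀ {i j} → i ≈ j → j ≈ i
  ≈-sym (mk≈ e) = mk≈ (sym e)

  ≈-trans : ∀ {i j k} → i ≈ j → j ≈ k → i ≈ k
  ≈-trans (mk≈ e) (mk≈ f) = mk≈ (trans e f)

  ≡⇒≈ : ∀ {i j} → i ≡ j → i ≈ j
  ≡⇒≈ refl = ≈-refl

  _≈?_ : ∀ i j → Dec (i ≈ j)
  i ≈? j with i % n Data.Nat.≟ j % n
  ... | yes e = yes (mk≈ e)
  ... | no ne = no (λ e → ne (un≈ e))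

  ≈-+ : ∀ {i j} d → i ≈ j → i + d ≈ j + d
  ≈-+ {i} {j} d (mk≈ e) = mk≈ (begin
    (i + d) % n          ≡⟨ %-distribˡ-+ i d n ⟩
    (i % n + d % n) % n  ≡⟨ cong (λ z → (z + d % n) % n) e ⟩
    (j % n + d % n) % n  ≡⟨ sym (%-distribˡ-+ j d n) ⟩
    (j + d) % n          ∎)
    where open ≡-Reasoning

  ≈-n : ∀ i → i + n ≈ i
  ≈-n i = mk≈ ([m+n]%n≡m%n i n)

  ≈-kn : ∀ i k → i + k * n ≈ i
  ≈-kn i k = mk≈ ([m+kn]%n≡m%n i k n)

  toℕ-pos-≈ : ∀ i → toℕ (pos i) ≈ i
  toℕ-pos-≈ i = mk≈ (trans (cong (_% n) (toℕ-pos i)) (m%n%n≡m%n i n))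

  pos-toℕ : ∀ (v : Fin n) → pos (toℕ v) ≡ v
  pos-toℕ v = toℕ-injective (trans (toℕ-pos (toℕ v)) (m<n⇒m%n≡m (toℕ<n v)))

  ≈-small : ∀ {i j} → i < n → j < n → i ≈ j → i ≡ j
  ≈-small i<n j<n (mk≈ e) = trans (sym (m<n⇒m%n≡m i<n)) (trans e (m<n⇒m%n≡m j<n))

  ≈-suc : ∀ {i j} → i ≈ j → suc i ≈ suc j
  ≈-suc {i} {j} e = ≈-trans (≡⇒≈ (+-comm 1 i)) (≈-trans (≈-+ 1 e) (≡⇒≈ (+-comm j 1)))

  ≈-suc-cancel : ∀ {i j} → suc i ≈ suc j → i ≈ j
  ≈-suc-cancel {i} {j} e = ≈-trans (≈-sym (≈-n i)) (≈-trans (≡⇒≈ (shift i))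
                             (≈-trans (≈-+ (suc (suc n₀)) e) (≈-trans (≡⇒≈ (sym (shift j))) (≈-n j))))
    where
    shift : ∀ x → x + n ≡ suc x + suc (suc n₀)
    shift x = +-suc x (suc (suc n₀))

  ≈-ss : ∀ {i j} → i ≈ j → suc (suc i) ≈ suc (suc j)
  ≈-ss e = ≈-suc (≈-suc e)

  ≈-ss-cancel : ∀ {i j} → suc (suc i) ≈ suc (suc j) → i ≈ j
  ≈-ss-cancel e = ≈-suc-cancel (≈-suc-cancel e)

  shift-≈ : ∀ x d → x + d ≈ x → n ∣ d
  shift-≈ x d (mk≈ e) = divides ((x + d) / n ∸ x / n) (begin
    d                                                ≡⟨ sym (m+n∸m≡n x d) ⟩
    x + d ∸ x                                        ≡⟨ cong₂ _∸_ (m≡m%n+[m/n]*n (x + d) n) (m≡m%n+[m/n]*n x n) ⟩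
    ((x + d) % n + (x + d) / n * n) ∸ (x % n + x / n * n) ≡⟨ cong (λ r → (r + (x + d) / n * n) ∸ (x % n + x / n * n)) e ⟩
    (x % n + (x + d) / n * n) ∸ (x % n + x / n * n)  ≡⟨ [m+n]∸[m+o]≡n∸o (x % n) _ _ ⟩
    (x + d) / n * n ∸ x / n * n                      ≡⟨ sym (*-distribʳ-∸ n ((x + d) / n) (x / n)) ⟩
    ((x + d) / n ∸ x / n) * n                        ∎)
    where open ≡-Reasoning

  -- Since n ≥ 3, two steps along the cycle never return to the start.
  two-steps-move : ∀ i → ¬ (suc (suc i) ≈ i)
  two-steps-move i e with ∣⇒≤ (shift-≈ i 2 (≈-trans (≡⇒≈ (+-comm i 2)) e))
  ... | s≤s (s≤s ())

  infix 4 _∈ₙ_ _∉ₙ_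
  _∈ₙ_ : ℕ → Subset n → Set
  i ∈ₙ S = pos i ∈ S
  _∉ₙ_ : ℕ → Subset n → Set
  i ∉ₙ S = ¬ (i ∈ₙ S)

  ∈ₙ? : ∀ i S → Dec (i ∈ₙ S)
  ∈ₙ? i S = pos i ∈? S

  ∈-≈ : ∀ {i j S} → i ≈ j → i ∈ₙ S → j ∈ₙ S
  ∈-≈ {S = S} e h = subst (_∈ S) (pos-≈ e) h

  -- Insertion and deletion of the vertex named by a number.  They are kept
  -- opaque so that the modular arithmetic inside 'pos' is never unfolded.
  opaque
    add : Subset n → ℕ → Subset n
    add S x = S ∪ ⁅ pos x ⁆

    del : Subset n → ℕ → Subset n
    del S y = S - pos y

  opaque
    unfolding add del

    add-inv : ∀ {S x i} → i ∈ₙ add S x → i ∈ₙ S ⊎ i ≈ x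
    add-inv {S} h with ∈∪⁅⁆-inv S h
    ... | inj₁ a = inj₁ a
    ... | inj₂ e = inj₂ (≈-pos e)

    add-l : ∀ {S x i} → i ∈ₙ S → i ∈ₙ add S x
    add-l {S} h = ∈∪⁅⁆-l S h

    add-r : ∀ {S x i} → i ≈ x → i ∈ₙ add S x
    add-r {S} {x} e = subst (_∈ S ∪ ⁅ pos x ⁆) (sym (pos-≈ e)) (∈∪⁅⁆-r (pos x) S)

    add-sub : ∀ {S x} → S ⊆ add S x
    add-sub {S} h = ∈∪⁅⁆-l S h

    del-inv : ∀ {S y i} → i ∈ₙ del S y → i ∈ₙ S × ¬ (i ≈ y)
    del-inv {S} {y} h with ∈-del-inv S (pos y) h
    ... | a , b = a , λ e → b (pos-≈ e)

    del-i : ∀ {S y i} → i ∈ₙ S → ¬ (i ≈ y) → i ∈ₙ del S y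
    del-i h ne = x∈p∧x≢y⇒x∈p-y h (λ e → ne (≈-pos e))

    del-sub : ∀ {S y} → del S y ⊆ S
    del-sub {S} {y} h = proj₁ (∈-del-inv S (pos y) h)

    ∉delₙ-self : ∀ {S y} → y ∉ₙ del S y
    ∉delₙ-self {S} {y} = ∉-del-self S (pos y)

    size-addₙ : ∀ {S x} → x ∉ₙ S → ∣ add S x ∣ ≡ suc ∣ S ∣
    size-addₙ {S} {x} h = size-add S (pos x) h

    size-delₙ : ∀ {S y} → y ∈ₙ S → suc ∣ del S y ∣ ≡ ∣ S ∣
    size-delₙ {S} {y} h = size-del S (pos y) h

    del-addₙ : ∀ {S y} → y ∈ₙ S → (del S y) ∪ ⁅ pos y ⁆ ≡ S
    del-addₙ {S} {y} h = del-add S (pos y) h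

    add-def : ∀ {S x} → add S x ≡ S ∪ ⁅ pos x ⁆
    add-def = refl

    del-def : ∀ {S y} → del S y ≡ S - pos y
    del-def = refl

    del-toℕ : ∀ S (v : Fin n) → del S (toℕ v) ≡ S - v
    del-toℕ S v = cong (S -_) (pos-toℕ v)

  ∉del-≈ : ∀ {T y z} → z ≈ y → z ∉ₙ del T y
  ∉del-≈ e h = proj₂ (del-inv h) e

  ∉del-split : ∀ {T y z} → z ∉ₙ del T y → z ∉ₙ T ⊎ z ≈ y
  ∉del-split {T} {y} {z} h with z ≈? y
  ... | yes e = inj₂ e
  ... | no ne = inj₁ (λ zT → h (del-i zT ne))

-- Vertex i+1 is dominated
-- exactly by i and i+2, so S is a TDS iff every pair {i, i+2} meets S: S is
-- a vertex cover of the "two-step" graph i ~ i+2.  This module proves the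
-- equivalence, characterises minimality by irredundance, and makes all
-- notions decidable (needed for the finite searches).
module TwoStepCovers (n₀ : ℕ) where

  open import Data.Nat using (suc; _+_; s≤s; z≤n)
  open import Data.Nat.Properties using (+-suc; m≤n⇒m<n∨m≡n)
  open import Data.Fin using (Fin; toℕ)
  open import Data.Fin.Properties using (toℕ<n; any?; all?; ¬∀⟶∃¬)
  open import Data.Fin.Subset
  open import Data.Fin.Subset.Properties using (_∈?_; x∈p∧x≢y⇒x∈p-y)
  open import Data.Product using (_×_; _,_; proj₁; proj₂; ∃-syntax)
  open import Data.Sum using (_⊎_; inj₁; inj₂)
  open import Data.Empty using (⊥-elim)
  open import Relation.Nullary using (¬_; yes; no; Dec)
  open import Relation.Nullary.Decidable using (_×-dec_; _⊎-dec_; _→-dec_; ¬?)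
  open import Relation.Binary.PropositionalEquality
  open CyclePositions n₀

  Cover : Subset n → Set
  Cover S = ∀ i → i ∈ₙ S ⊎ suc (suc i) ∈ₙ S

  adjacent-suc : ∀ {v u : Fin n} → suc (toℕ v) ≈ toℕ u → CycleAdj n v u
  adjacent-suc {v} {u} e with m≤n⇒m<n∨m≡n (toℕ<n v)
  ... | inj₁ sv<n = inj₁ (≈-small sv<n (toℕ<n u) e)
  ... | inj₂ sv≡n = inj₂ (inj₂ (inj₂ (u≡0 , sv≡n)))
    where
    u≡0 : toℕ u ≡ 0
    u≡0 = ≈-small (toℕ<n u) (s≤s z≤n)
            (≈-trans (≈-sym e) (≈-trans (≡⇒≈ sv≡n) (≈-n 0)))

  adjacent-≈ : ∀ {v u : Fin n} → CycleAdj n v u → suc (toℕ v) ≈ toℕ u ⊎ suc (toℕ u) ≈ toℕ v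
  adjacent-≈ (inj₁ e) = inj₁ (≡⇒≈ e)
  adjacent-≈ (inj₂ (inj₁ e)) = inj₂ (≡⇒≈ e)
  adjacent-≈ (inj₂ (inj₂ (inj₁ (v≡0 , su≡n)))) =
    inj₂ (≈-trans (≡⇒≈ su≡n) (≈-trans (≈-n 0) (≡⇒≈ (sym v≡0))))
  adjacent-≈ (inj₂ (inj₂ (inj₂ (u≡0 , sv≡n)))) =
    inj₁ (≈-trans (≡⇒≈ sv≡n) (≈-trans (≈-n 0) (≡⇒≈ (sym u≡0))))

  adjacent-sym : ∀ {v u : Fin n} → CycleAdj n u v → CycleAdj n v u
  adjacent-sym (inj₁ e) = inj₂ (inj₁ e)
  adjacent-sym (inj₂ (inj₁ e)) = inj₁ e
  adjacent-sym (inj₂ (inj₂ (inj₁ x))) = inj₂ (inj₂ (inj₂ x))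
  adjacent-sym (inj₂ (inj₂ (inj₂ x))) = inj₂ (inj₂ (inj₁ x))

  -- v - 1 is named by v + (n - 1).
  pred-name : ∀ x → suc (x + suc (suc n₀)) ≈ x
  pred-name x = ≈-trans (≡⇒≈ (sym (+-suc x (suc (suc n₀))))) (≈-n x)

  -- Vertex v is dominated by v-1 or v+1, i.e. by i or i+2 for i = v-1.
  cover⇒tds : ∀ {S} → Cover S → IsTDS n S
  cover⇒tds {S} cover v with cover (toℕ v + suc (suc n₀))
  ... | inj₁ before = pos (toℕ v + suc (suc n₀)) , before ,
          adjacent-sym (adjacent-suc (≈-trans (≈-suc (toℕ-pos-≈ _)) (pred-name (toℕ v))))
  ... | inj₂ after = pos (suc (suc (toℕ v + suc (suc n₀)))) , after ,
          adjacent-suc (≈-trans (≈-suc (≈-sym (pred-name (toℕ v)))) (≈-sym (toℕ-pos-≈ _)))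

  -- The neighbour in S of vertex i+1 is i or i+2.
  tds⇒cover : ∀ {S} → IsTDS n S → Cover S
  tds⇒cover {S} t i with t (pos (suc i))
  ... | u , u∈S , adj with adjacent-≈ adj
  ...   | inj₁ e = inj₂ (subst (_∈ S) (sym (trans (pos-≈ ss≈u) (pos-toℕ u))) u∈S)
    where
    ss≈u : suc (suc i) ≈ toℕ u
    ss≈u = ≈-trans (≈-suc (≈-sym (toℕ-pos-≈ (suc i)))) e
  ...   | inj₂ e = inj₁ (subst (_∈ S) (sym (trans (pos-≈ i≈u) (pos-toℕ u))) u∈S)
    where
    i≈u : i ≈ toℕ u
    i≈u = ≈-suc-cancel (≈-sym (≈-trans e (toℕ-pos-≈ (suc i))))

  cover-mono : ∀ {S T} → Cover S → S ⊆ T → Cover T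
  cover-mono t sub i with t i
  ... | inj₁ a = inj₁ (sub a)
  ... | inj₂ b = inj₂ (sub b)

  add-cover : ∀ {S} x → Cover S → Cover (add S x)
  add-cover {S} x t = cover-mono t (add-sub {S} {x})

  del-cover : ∀ {S y} → Cover S → suc (suc y) ∈ₙ S → (∀ i → suc (suc i) ≈ y → i ∈ₙ S) → Cover (del S y)
  del-cover {S} {y} t hy hl i with i ≈? y
  ... | yes e = inj₂ (del-i (∈-≈ (≈-sym (≈-ss e)) hy) (λ e' → two-steps-move y (≈-trans (≈-sym (≈-ss e)) e')))
  ... | no ne with suc (suc i) ≈? y
  ...   | yes e2 = inj₁ (del-i (hl i e2) ne)
  ...   | no ne2 with t i
  ...     | inj₁ a = inj₁ (del-i a ne)
  ...     | inj₂ b = inj₂ (del-i b ne2)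

  notCover : ∀ {T} i → i ∉ₙ T → suc (suc i) ∉ₙ T → ¬ Cover T
  notCover i a b t with t i
  ... | inj₁ x = a x
  ... | inj₂ x = b x

  witness : ∀ T → ¬ Cover T → ∃[ i ] (i ∉ₙ T × suc (suc i) ∉ₙ T)
  witness T nt with all? (λ (v : Fin n) → ∈ₙ? (toℕ v) T ⊎-dec ∈ₙ? (suc (suc (toℕ v))) T)
  ... | yes all = ⊥-elim (nt λ i → transport i (all (pos i)))
    where
    transport : ∀ i → toℕ (pos i) ∈ₙ T ⊎ suc (suc (toℕ (pos i))) ∈ₙ T → i ∈ₙ T ⊎ suc (suc i) ∈ₙ T
    transport i (inj₁ h) = inj₁ (∈-≈ (toℕ-pos-≈ i) h)
    transport i (inj₂ h) = inj₂ (∈-≈ (≈-ss (toℕ-pos-≈ i)) h)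
  ... | no nall with ¬∀⟶∃¬ n _ (λ (v : Fin n) → ∈ₙ? (toℕ v) T ⊎-dec ∈ₙ? (suc (suc (toℕ v))) T) nall
  ...   | v , nv = toℕ v , (λ h → nv (inj₁ h)) , (λ h → nv (inj₂ h))

  -- Irredundance: no single vertex can be dropped.  For covers this is the
  -- same as minimality, since covering is upward closed.
  Irredundant : Subset n → Set
  Irredundant S = ∀ y → y ∈ₙ S → ¬ Cover (del S y)

  minimal← : ∀ {S} → Cover S → Irredundant S → IsMinimalTDS n S
  minimal← {S} t irredundant = cover⇒tds t , λ T T⊂S tT → noProper T T⊂S (tds⇒cover tT)
    where
    noProper : ∀ T → T ⊂ S → ¬ Cover T
    noProper T (T⊆S , x , xS , xT) tT = irredundant (toℕ x) (subst (_∈ S) (sym (pos-toℕ x)) xS)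
      (cover-mono tT λ {z} zT → subst (z ∈_) (sym (del-toℕ S x))
                                 (x∈p∧x≢y⇒x∈p-y (T⊆S zT) (λ { refl → xT zT })))

  minimal→ : ∀ {S} → IsMinimalTDS n S → Cover S × Irredundant S
  minimal→ {S} (t , m) = tds⇒cover t , λ y yS td →
    m (del S y) (del-sub {S} {y} , pos y , yS , ∉delₙ-self {S} {y}) (cover⇒tds td)

  adj? : ∀ (v u : Fin n) → Dec (CycleAdj n v u)
  adj? v u = (suc (toℕ v) Data.Nat.≟ toℕ u) ⊎-dec ((suc (toℕ u) Data.Nat.≟ toℕ v) ⊎-dec
    (((toℕ v Data.Nat.≟ 0) ×-dec (suc (toℕ u) Data.Nat.≟ n))
      ⊎-dec ((toℕ u Data.Nat.≟ 0) ×-dec (suc (toℕ v) Data.Nat.≟ n))))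

  tds? : ∀ S → Dec (IsTDS n S)
  tds? S = all? (λ v → any? (λ u → (u ∈? S) ×-dec adj? v u))

  IrredundantTDS : Subset n → Set
  IrredundantTDS S = ∀ v → v ∈ S → ¬ IsTDS n (S - v)

  irredundantTDS? : ∀ S → Dec (IrredundantTDS S)
  irredundantTDS? S = all? (λ v → (v ∈? S) →-dec ¬? (tds? (S - v)))

  fromIrredundantTDS : ∀ {S} → IrredundantTDS S → Irredundant S
  fromIrredundantTDS {S} f y yS td = f (pos y) yS (subst (IsTDS n) (del-def {S} {y}) (cover⇒tds td))

  toIrredundantTDS : ∀ {S} → Irredundant S → IrredundantTDS S
  toIrredundantTDS {S} f v vS td = f (toℕ v) (subst (_∈ S) (sym (pos-toℕ v)) vS) (subst Cover (sym (del-toℕ S v)) (tds⇒cover td))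

  minimal? : ∀ S → Dec (IsMinimalTDS n S)
  minimal? S with tds? S | irredundantTDS? S
  ... | yes t | yes i = yes (minimal← (tds⇒cover t) (fromIrredundantTDS i))
  ... | no ¬t | _ = no (λ m → ¬t (proj₁ m))
  ... | yes t | no ¬i = no (λ m → ¬i (toIrredundantTDS (proj₂ (minimal→ m))))

-- The elementary moves in D_k^t(C_n): inserting a vertex, deleting a vertex,
-- and a "slide" (insert x, then delete y) which keeps the cardinality and
-- needs one unit of spare budget.
module Moves (n₀ k : ℕ) where

  open import Data.Nat using (zero; suc; _≤_)
  open import Data.Nat.Properties using (≤-trans; ≤-pred; n≤1+n; suc-injective)
  open import Data.Fin using (toℕ)
  open import Data.Fin.Subset
  open import Data.Fin.Subset.Properties using (_∈?_)
  open import Data.Fin.Properties using (¬∀⟶∃¬)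
  open import Data.Product using (_×_; _,_; ∃-syntax)
  open import Data.Sum using (inj₁; inj₂)
  open import Data.Empty using (⊥-elim)
  open import Relation.Nullary using (¬_; yes; no)
  open import Relation.Nullary.Decidable using (_→-dec_; ¬?)
  open import Relation.Binary.PropositionalEquality
  open Walks
  open CyclePositions n₀
  open TwoStepCovers n₀

  R : Subset n → Subset n → Set
  R = Reach n k

  mv-add : ∀ {S x} → Cover S → x ∉ₙ S → suc ∣ S ∣ ≤ k → R S (add S x)
  mv-add {S} {x} t nx le = one (cover⇒tds (add-cover x t) , subst (_≤ k) (sym (size-addₙ {S} {x} nx)) le)
                               (inj₁ (pos x , nx , add-def {S} {x}))

  mv-del : ∀ {S y} → Cover (del S y) → y ∈ₙ S → ∣ S ∣ ≤ k → R S (del S y)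
  mv-del {S} {y} t yS le = one (cover⇒tds t , ≤-trans (n≤1+n _) (subst (_≤ k) (sym (size-delₙ {S} {y} yS)) le))
                               (inj₂ (pos y , ∉delₙ-self {S} {y} , sym (del-addₙ {S} {y} yS)))

  record Slid (S : Subset n) (x y : ℕ) : Set where
    field
      path : R S (del (add S x) y)
      tds  : Cover (del (add S x) y)
      size : ∣ del (add S x) y ∣ ≡ ∣ S ∣

  mv-slide : ∀ {S x y} → Cover S → x ∉ₙ S → y ∈ₙ S → suc (suc y) ∈ₙ add S x
    → (∀ i → suc (suc i) ≈ y → i ∈ₙ add S x) → suc ∣ S ∣ ≤ k → Slid S x y
  mv-slide {S} {x} {y} t nx yS hy hl le = record
    { path = trans-R (mv-add t nx le) (mv-del td (add-l yS) (subst (_≤ k) (sym grown) le))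
    ; tds = td
    ; size = suc-injective (trans (size-delₙ {add S x} {y} (add-l yS)) grown) }
    where
    grown = size-addₙ {S} {x} nx
    td : Cover (del (add S x) y)
    td = del-cover (add-cover x t) hy hl

  opaque
    removable : ∀ S → ¬ IrredundantTDS S → ∃[ v ] (v ∈ S × IsTDS n (S - v))
    removable S red with ¬∀⟶∃¬ n _ (λ v → (v ∈? S) →-dec ¬? (tds? (S - v))) red
    ... | v , h with v ∈? S | tds? (S - v)
    ...   | yes v∈S | yes tv = v , v∈S , tv
    ...   | no v∉S | _ = ⊥-elim (h (λ v∈S → ⊥-elim (v∉S v∈S)))
    ...   | _ | no ¬tv = ⊥-elim (h (λ _ → ¬tv))

  record Reduced (S : Subset n) : Set where
    field
      M : Subset n
      path : R S M
      coverM : Cover M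
      irredundantM : Irredundant M
      sub : M ⊆ S

  -- Delete removable vertices until none is left; f bounds the number of
  -- deletions.
  reduce : ∀ f S → ∣ S ∣ ≤ f → Cover S → ∣ S ∣ ≤ k → Reduced S
  reduce f S le t lk with irredundantTDS? S
  ... | yes irredundant = record { M = S ; path = here ; coverM = t ; irredundantM = fromIrredundantTDS irredundant ; sub = λ h → h }
  reduce zero S le t lk | no red with removable S red
  ... | v , v∈S , _ with subst (_≤ 0) (sym (size-delₙ {S} {toℕ v} (subst (_∈ S) (sym (pos-toℕ v)) v∈S))) le
  ...   | ()
  reduce (suc f) S le t lk | no red with removable S red
  ... | v , v∈S , tv = record
      { M = Reduced.M rest ; path = trans-R (mv-del td v∈ₙS lk) (Reduced.path rest)
      ; coverM = Reduced.coverM rest ; irredundantM = Reduced.irredundantM rest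
      ; sub = λ z → del-sub {S} {toℕ v} (Reduced.sub rest z) }
    where
    v∈ₙS : toℕ v ∈ₙ S
    v∈ₙS = subst (_∈ S) (sym (pos-toℕ v)) v∈S
    shrunk : suc ∣ del S (toℕ v) ∣ ≡ ∣ S ∣
    shrunk = size-delₙ {S} {toℕ v} v∈ₙS
    td : Cover (del S (toℕ v))
    td = subst Cover (sym (del-toℕ S v)) (tds⇒cover tv)
    rest : Reduced (del S (toℕ v))
    rest = reduce f (del S (toℕ v)) (≤-pred (subst (_≤ suc f) (sym shrunk) le)) td
                  (≤-trans (n≤1+n _) (subst (_≤ k) (sym shrunk) lk))

-- Suppose every minimal TDS has at most g ≤ B
-- vertices and every cover of size at most B can walk (inside D_k^t) to a
-- cover satisfying Canon, a property shared by at most one set.  Then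
-- D_k^t(C_n) is connected: each vertex first walks down to a minimal TDS by
-- deletions, then to the canonical set, and two such walks are joined by
-- reversing one of them.
module Canonical (n₀ k : ℕ) where

  open import Data.Nat using (_≤_)
  open import Data.Nat.Properties using (≤-refl; ≤-trans)
  open import Data.Fin.Subset using (Subset; ∣_∣)
  open import Data.Product using (_,_; proj₁; proj₂; Σ)
  open import Relation.Binary.PropositionalEquality using (_≡_; subst)
  open Walks
  open CyclePositions n₀
  open TwoStepCovers n₀
  open Moves n₀ k

  module _ (Canon : Subset n → Set)
           (uniq : ∀ {S T} → Canon S → Canon T → S ≡ T)
           (B : ℕ) (canon : ∀ S → Cover S → ∣ S ∣ ≤ B → Σ (Subset n) λ S' → R S S' × Canon S')
           (g : ℕ) (gB : g ≤ B) (gmax : ∀ M → IsMinimalTDS n M → ∣ M ∣ ≤ g) where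

    toCanon : ∀ S → IsDVertex n k S → Σ (Subset n) λ C → R S C × Canon C
    toCanon S (tS , sS) with reduce ∣ S ∣ S ≤-refl (tds⇒cover tS) sS
    ... | red with canon (Reduced.M red) (Reduced.coverM red)
                   (≤-trans (gmax (Reduced.M red) (minimal← (Reduced.coverM red) (Reduced.irredundantM red))) gB)
    ...   | C , pc , cc = C , trans-R (Reduced.path red) pc , cc

    connected : DConnected n k
    connected S T dS dT = trans-R (proj₁ (proj₂ fromS))
                            (subst (λ Z → R Z T) (uniq (proj₂ (proj₂ fromT)) (proj₂ (proj₂ fromS)))
                                   (rev-R dT (proj₁ (proj₂ fromT))))
      where
      fromS = toCanon S dS
      fromT = toCanon T dT

-- Moves that keep the size within a budget B (with one spare unit, B < k,
-- available for slides), and the "chain" of slides that pulls a vertex of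
-- S backwards along the two-step cycle in steps of 4.
module Chains (n₀ k B : ℕ) (Bk : suc B ≤ k) where

  open import Data.Nat using (zero; suc; _+_; _*_; _≤_; s≤s; z≤n)
  open import Data.Nat.Properties
  open import Data.Fin.Subset using (Subset; ∣_∣)
  open import Data.Product using (_×_; _,_; proj₁; ∃-syntax; Σ)
  open import Data.Sum using (_⊎_; inj₁; inj₂; [_,_]; map₂)
  open import Data.Empty using (⊥-elim)
  open import Relation.Nullary using (¬_; yes; no)
  open import Relation.Binary.PropositionalEquality hiding ([_])
  open Walks
  open CyclePositions n₀
  open TwoStepCovers n₀
  open Moves n₀ k

  spare : ∀ {m} → m ≤ B → suc m ≤ k
  spare le = ≤-trans (s≤s le) Bk

  record Move (S : Subset n) (New : ℕ → Set) : Set where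
    field
      S' : Subset n
      path : R S S'
      tds : Cover S'
      size : ∣ S' ∣ ≤ B
      fresh : ∀ x → x ∈ₙ S' → x ∈ₙ S ⊎ New x

  kept-out : ∀ {S New} (r : Move S New) x → x ∉ₙ S → ¬ New x → x ∉ₙ Move.S' r
  kept-out r x x∉S notNew x∈S' with Move.fresh r x x∈S'
  ... | inj₁ x∈S = x∉S x∈S
  ... | inj₂ new = notNew new

  stay : ∀ {S New} → Cover S → ∣ S ∣ ≤ B → Move S New
  stay {S} t le = record { S' = S ; path = here ; tds = t ; size = le ; fresh = λ _ → inj₁ }

  then : ∀ {S P Q} (r : Move S P) → Move (Move.S' r) Q → Move S (λ x → P x ⊎ Q x)
  then {S} {P} {Q} r r' = record
    { S' = Move.S' r' ; path = trans-R (Move.path r) (Move.path r') ; tds = Move.tds r'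
    ; size = Move.size r' ; fresh = fresh }
    where
    fresh : ∀ x → x ∈ₙ Move.S' r' → x ∈ₙ S ⊎ (P x ⊎ Q x)
    fresh x h with Move.fresh r' x h
    ... | inj₂ q = inj₂ (inj₂ q)
    ... | inj₁ h' with Move.fresh r x h'
    ...   | inj₁ s = inj₁ s
    ...   | inj₂ p = inj₂ (inj₁ p)

  weaken : ∀ {S P Q} → (∀ x → P x → Q x) → Move S P → Move S Q
  weaken f r = record
    { S' = Move.S' r ; path = Move.path r ; tds = Move.tds r ; size = Move.size r
    ; fresh = λ x h → map₂ (f x) (Move.fresh r x h) }

  deletion : ∀ {S y New} → Cover (del S y) → y ∈ₙ S → ∣ S ∣ ≤ B → Move S New
  deletion {S} {y} td yS le = record
    { S' = del S y ; path = mv-del td yS (≤-trans le (≤-trans (n≤1+n B) Bk)) ; tds = td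
    ; size = ≤-trans (≤-trans (n≤1+n _) (≤-reflexive (size-delₙ {S} {y} yS))) le
    ; fresh = λ x h → inj₁ (del-sub {S} {y} h) }

  sliding : ∀ {S x y} → Slid S x y → ∣ S ∣ ≤ B → Move S (_≈ x)
  sliding {S} {x} {y} sl le = record
    { S' = del (add S x) y ; path = Slid.path sl ; tds = Slid.tds sl
    ; size = ≤-trans (≤-reflexive (Slid.size sl)) le
    ; fresh = λ z h → add-inv (proj₁ (del-inv h)) }

  evict : ∀ {S} a L → Cover S → ∣ S ∣ ≤ B → a ∈ₙ S → suc (suc a) ∈ₙ S → suc (suc L) ≈ a →
          Σ (Move S (_≈ L)) λ r → a ∉ₙ Move.S' r
  evict {S} a L t le aS a2 eL with ∈ₙ? L S
  ... | yes LS = deletion (del-cover t a2 (λ i e → ∈-≈ (≈-ss-cancel (≈-trans eL (≈-sym e))) LS)) aS le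
               , ∉delₙ-self {S} {a}
  ... | no LS = sliding (mv-slide t LS aS (add-l a2) (λ i e → add-r (≈-ss-cancel (≈-trans e (≈-sym eL)))) (spare le)) le
              , ∉delₙ-self {add S L} {a}

  ch : ℕ → ℕ → ℕ
  ch c t = c + 4 * t

  ch-suc : ∀ c t → ch (c + 4) t ≡ ch c (suc t)
  ch-suc c t = trans (+-assoc c 4 (4 * t)) (cong (c +_) (sym (*-suc 4 t)))

  ch0 : ∀ c → ch c 0 ≡ c
  ch0 c = +-identityʳ c

  -- One slide: if c is absent and c+4 present, then c+2 is present (the pair
  -- {c, c+2} is covered) and may be slid back to c.
  slide1 : ∀ {S} c → Cover S → ∣ S ∣ ≤ B → c ∉ₙ S → suc (suc (suc (suc c))) ∈ₙ S →
           Σ (Move S (_≈ c)) λ r → c ∈ₙ Move.S' r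
  slide1 {S} c t le cS c4 = sliding sl le , del-i (add-r ≈-refl) (λ e → two-steps-move c (≈-sym e))
    where
    c2 : suc (suc c) ∈ₙ S
    c2 with t c
    ... | inj₁ p = ⊥-elim (cS p)
    ... | inj₂ p = p
    sl : Slid S c (suc (suc c))
    sl = mv-slide t cS c2 (add-l c4) (λ i e → add-r (≈-ss-cancel e)) (spare le)

  OnChain : ℕ → ℕ → ℕ → Set
  OnChain c j x = ∃[ t ] (t ≤ j × x ≈ ch c t)

  onChain-shift : ∀ {c j} x → OnChain (c + 4) j x → OnChain c (suc j) x
  onChain-shift {c} x (u , u≤ , e) = suc u , s≤s u≤ , ≈-trans e (≡⇒≈ (ch-suc c u))

  onChain-start : ∀ {c j} x → x ≈ c → OnChain c j x
  onChain-start {c} x e = 0 , z≤n , ≈-trans e (≡⇒≈ (sym (ch0 c)))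

  -- If c, c+4, ..., c+4j are absent and c+4(j+1) is present, slides from the
  -- far end backwards bring a vertex to c; only chain positions enter.
  chain : ∀ j c {S} → Cover S → ∣ S ∣ ≤ B → (∀ t → t ≤ j → ch c t ∉ₙ S) → ch c (suc j) ∈ₙ S →
          Σ (Move S (OnChain c j)) λ r → c ∈ₙ Move.S' r
  chain zero c {S} t le toks stop with slide1 c t le (subst (_∉ₙ S) (ch0 c) (toks 0 z≤n)) (subst (_∈ₙ S) (+-comm c 4) stop)
  ... | r , cin = weaken (onChain-start {c}) r , cin
  chain (suc j) c {S} t le toks stop
    with chain j (c + 4) t le (λ u u≤ → subst (_∉ₙ S) (sym (ch-suc c u)) (toks (suc u) (s≤s u≤)))
                              (subst (_∈ₙ S) (sym (ch-suc c (suc j))) stop)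
  ... | r , c4in with ∈ₙ? c (Move.S' r)
  ...   | yes cin = weaken (onChain-shift {c}) r , cin
  ...   | no cout with slide1 c (Move.tds r) (Move.size r) cout (subst (_∈ₙ Move.S' r) (+-comm c 4) c4in)
  ...     | r' , cin = weaken (λ x → [ onChain-shift {c} x , onChain-start {c} x ]) (then r r') , cin

  search : ∀ c {S} → c ∉ₙ S → ∀ J → (∀ t → t ≤ J → ch c t ∉ₙ S) ⊎ (∃[ j ] ((∀ t → t ≤ j → ch c t ∉ₙ S) × ch c (suc j) ∈ₙ S))
  search c {S} cS zero = inj₁ λ { zero _ → subst (_∉ₙ S) (sym (ch0 c)) cS ; (suc t) () }
  search c {S} cS (suc J) with search c cS J
  ... | inj₂ r = inj₂ r
  ... | inj₁ all with ∈ₙ? (ch c (suc J)) S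
  ...   | yes p = inj₂ (J , all , p)
  ...   | no np = inj₁ allUpTo
    where
    allUpTo : ∀ t → t ≤ suc J → ch c t ∉ₙ S
    allUpTo t t≤ with m≤n⇒m<n∨m≡n t≤
    ... | inj₁ lt = all t (≤-pred lt)
    ... | inj₂ refl = np

-- The generic
-- procedure 'base' handles everything except covers that are "all tokens"
-- along the chain a+2, a+6, ..., a+2+4J; that remaining case is delegated
-- to a Handler, which depends on n.
module Eviction (n₀ k B : ℕ) (Bk : suc B ≤ k) where

  open import Data.Nat using (suc; _+_; _*_; _≤_; z≤n)
  open import Data.Nat.Properties using (≤-refl)
  open import Data.Nat.Tactic.RingSolver using (solve-∀)
  open import Data.Fin.Subset using (Subset; ∣_∣)
  open import Data.Product using (_,_; ∃-syntax; Σ)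
  open import Data.Sum using (inj₁; inj₂; [_,_])
  open import Data.Empty using (⊥-elim)
  open import Relation.Nullary using (yes; no)
  open import Relation.Binary.PropositionalEquality hiding ([_])
  open CyclePositions n₀
  open TwoStepCovers n₀
  open Moves n₀ k
  open Chains n₀ k B Bk

  OnCycle : ℕ → ℕ → Set
  OnCycle a x = ∃[ m ] (x ≈ a + 2 * m)

  Evicts : ℕ → Subset n → Set
  Evicts a S = Σ (Move S (OnCycle a)) λ r → a ∉ₙ Move.S' r

  onCycle : ∀ a {x} m → x ≈ a + 2 * m → OnCycle a x
  onCycle a m e = m , e

  onCycle-next : ∀ a x → x ≈ suc (suc a) → OnCycle a x
  onCycle-next a x e = onCycle a 1 (≈-trans e (≡⇒≈ (ss≡ a)))
    where
    ss≡ : ∀ a → suc (suc a) ≡ a + 2 * 1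
    ss≡ = solve-∀

  onCycle-chain : ∀ a {j} x → OnChain (suc (suc a)) j x → OnCycle a x
  onCycle-chain a x (t , _ , e) = onCycle a (1 + 2 * t) (≈-trans e (≡⇒≈ (chpos a t)))
    where
    chpos : ∀ a t → suc (suc a) + 4 * t ≡ a + 2 * (1 + 2 * t)
    chpos = solve-∀

  Handler : ℕ → ℕ → Set
  Handler a J = ∀ S → Cover S → ∣ S ∣ ≤ B → a ∈ₙ S → (∀ t → t ≤ J → ch (suc (suc a)) t ∉ₙ S) → Evicts a S

  -- L = a + 2hm is the predecessor a-2 of a on its two-step cycle.
  base : ∀ a hm J → suc (suc (a + 2 * hm)) ≈ a → Handler a J → ∀ S → Cover S → ∣ S ∣ ≤ B → Evicts a S
  base a hm J eL H S t le with ∈ₙ? a S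
  ... | no aS = stay t le , aS
  ... | yes aS with ∈ₙ? (suc (suc a)) S
  ...   | yes a2 with evict a (a + 2 * hm) t le aS a2 eL
  ...     | r , out = weaken (λ x → onCycle a hm) r , out
  base a hm J eL H S t le | yes aS | no a2 with ∈ₙ? (a + 2 * hm) S
  ...   | yes LS = weaken (onCycle-next a) (sliding sl le) , ∉delₙ-self {add S (suc (suc a))} {a}
    where
    sl : Slid S (suc (suc a)) a
    sl = mv-slide t a2 aS (add-r ≈-refl) (λ i e → add-l (∈-≈ (≈-ss-cancel (≈-trans eL (≈-sym e))) LS)) (spare le)
  ...   | no _ with search (suc (suc a)) a2 J
  ...     | inj₁ toks = H S t le aS toks
  ...     | inj₂ (j , toks , stop) with chain j (suc (suc a)) t le toks stop
  ...       | r , cin with ∈ₙ? a (Move.S' r)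
  ...         | no aout = weaken (onCycle-chain a) r , aout
  ...         | yes ain with evict a (a + 2 * hm) (Move.tds r) (Move.size r) ain cin eL
  ...           | r' , out = weaken (λ x → [ onCycle-chain a x , onCycle a hm ]) (then r r') , out

  -- If the chain from a+2 wraps around onto a+4 the all-token case cannot
  -- occur: the pair {a+2, a+4} would be uncovered.
  handler-contra : ∀ a J → (∀ c → c + 4 * J ≈ suc (suc c)) → Handler a J
  handler-contra a J e S t le aS toks with t (suc (suc a))
  ... | inj₁ p = ⊥-elim (subst (_∉ₙ S) (ch0 (suc (suc a))) (toks 0 z≤n) p)
  ... | inj₂ p = ⊥-elim (toks J ≤-refl (∈-≈ (≈-sym (e (suc (suc a)))) p))

  -- If the two-step cycle through a has length 2 (n = 4), slide a to a+2.
  handler-four : ∀ a J → (∀ i → suc (suc i) ≈ a → i ≈ suc (suc a)) → Handler a J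
  handler-four a J e S t le aS toks = weaken (onCycle-next a) (sliding sl le) , ∉delₙ-self {add S (suc (suc a))} {a}
    where
    a2 : suc (suc a) ∉ₙ S
    a2 = subst (_∉ₙ S) (ch0 (suc (suc a))) (toks 0 z≤n)
    sl : Slid S (suc (suc a)) a
    sl = mv-slide t a2 aS (add-r ≈-refl) (λ i ei → add-r (e i ei)) (spare le)

-- The all-token case for a two-step cycle of even length (n ≡ 0 mod 4):
-- a ∈ S while a+2, a+6, a+10, ... are all absent, so S alternates along the
-- cycle and no single slide helps.  Reduce S to a minimal cover M, insert
-- c = a+2 and a+6 and delete a+4; the result M⁺ has size ∣M∣+1 and contains
-- a and a+2, so a can then be evicted.  This costs two units of spare budget
-- over ∣M∣ (the 'Budget' hypothesis); when the chain has length at least 3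
-- (n ≥ 12), M⁺ is itself minimal, which makes one unit enough.
module AllTokens (n₀ k B : ℕ) (Bk : suc B ≤ k) where

  open import Data.Nat using (suc; _+_; _*_; _≤_; z≤n)
  open import Data.Nat.Properties using (≤-trans; ≤-refl; n≤1+n; suc-injective; +-comm)
  open import Data.Nat.Tactic.RingSolver using (solve-∀)
  open import Data.Fin.Subset using (Subset; ∣_∣)
  open import Data.Fin.Subset.Properties using (p⊆q⇒∣p∣≤∣q∣)
  open import Data.Product using (_×_; _,_; proj₁; proj₂)
  open import Data.Sum using (_⊎_; inj₁; inj₂; [_,_])
  open import Data.Empty using (⊥-elim)
  open import Relation.Nullary using (¬_; yes; no)
  open import Relation.Binary.PropositionalEquality hiding ([_])
  open Walks
  open CyclePositions n₀
  open TwoStepCovers n₀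
  open Moves n₀ k
  open Chains n₀ k B Bk
  open Eviction n₀ k B Bk

  module AllTokenCase (a J hm : ℕ) (eL : suc (suc (a + 2 * hm)) ≈ a) (J1 : 1 ≤ J) (no4 : ∀ x → ¬ (x + 4 ≈ x)) where

    c p4 p6 : ℕ
    c = suc (suc a)
    p4 = suc (suc c)
    p6 = ch c 1

    p6≡ : p6 ≡ suc (suc p4)
    p6≡ = +-comm c 4

    lift : Subset n → Subset n
    lift M = del (add (add M c) p6) p4

    AllTokensAt : Subset n → Set
    AllTokensAt M = Cover M × Irredundant M × a ∈ₙ M × (∀ t → t ≤ J → ch c t ∉ₙ M)

    Budget : Set
    Budget = ∀ M → AllTokensAt M → suc (suc ∣ M ∣) ≤ k × suc ∣ M ∣ ≤ B

    module Lift (M : Subset n) (tM : Cover M) (aM : a ∈ₙ M) (toks : ∀ t → t ≤ J → ch c t ∉ₙ M) where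

      c∉M : c ∉ₙ M
      c∉M = subst (_∉ₙ M) (ch0 c) (toks 0 z≤n)

      p6∉M : p6 ∉ₙ M
      p6∉M = toks 1 J1

      p4∈M : p4 ∈ₙ M
      p4∈M with tM c
      ... | inj₁ x = ⊥-elim (c∉M x)
      ... | inj₂ x = x

      p6∉M+c : p6 ∉ₙ add M c
      p6∉M+c h with add-inv h
      ... | inj₁ x = p6∉M x
      ... | inj₂ x = no4 c x

      size+c : ∣ add M c ∣ ≡ suc ∣ M ∣
      size+c = size-addₙ {M} {c} c∉M

      size+c+p6 : ∣ add (add M c) p6 ∣ ≡ suc (suc ∣ M ∣)
      size+c+p6 = trans (size-addₙ {add M c} {p6} p6∉M+c) (cong suc size+c)

      p4∈M+c+p6 : p4 ∈ₙ add (add M c) p6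
      p4∈M+c+p6 = add-l (add-l p4∈M)

      size-lift : ∣ lift M ∣ ≡ suc ∣ M ∣
      size-lift = suc-injective (trans (size-delₙ {add (add M c) p6} {p4} p4∈M+c+p6) size+c+p6)

      tds-lift : Cover (lift M)
      tds-lift = del-cover (add-cover p6 (add-cover c tM)) (add-r (≡⇒≈ (sym p6≡))) (λ i e → add-l (add-r (≈-ss-cancel e)))

      a∈lift : a ∈ₙ lift M
      a∈lift = del-i (add-l (add-l aM)) (λ e → no4 a (≈-trans (≡⇒≈ (+-comm a 4)) (≈-sym e)))

      c∈lift : c ∈ₙ lift M
      c∈lift = del-i (add-l (add-r ≈-refl)) (λ e → two-steps-move c (≈-sym e))

      path-lift : suc (suc ∣ M ∣) ≤ k → R M (lift M)
      path-lift b = trans-R (mv-add tM c∉M (≤-trans (n≤1+n _) b))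
                     (trans-R (mv-add (add-cover c tM) p6∉M+c (subst (λ z → suc z ≤ k) (sym size+c) b))
                              (mv-del tds-lift p4∈M+c+p6 (subst (_≤ k) (sym size+c+p6) b)))

      fresh-lift : ∀ x → x ∈ₙ lift M → x ∈ₙ M ⊎ (x ≈ c ⊎ x ≈ p6)
      fresh-lift x h with add-inv (proj₁ (del-inv h))
      ... | inj₂ p = inj₂ (inj₂ p)
      ... | inj₁ q with add-inv q
      ...   | inj₁ p = inj₁ p
      ...   | inj₂ p = inj₂ (inj₁ p)

      out-lift : ∀ x → x ∉ₙ M → ¬ (x ≈ c) → ¬ (x ≈ p6) → x ∉ₙ lift M
      out-lift x xM xc x6 h with fresh-lift x h
      ... | inj₁ p = xM p
      ... | inj₂ (inj₁ p) = xc p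
      ... | inj₂ (inj₂ p) = x6 p

    -- For a long chain the lifted cover is again minimal.  The side
    -- conditions say that the chain positions involved are distinct.
    module LiftMinimal (J2 : 2 ≤ J) (eJ : suc (suc (ch c J)) ≈ a)
                       (c+8≉c : ¬ (ch c 2 ≈ c)) (c+8≉c+4 : ¬ (ch c 2 ≈ p6)) (cJ≉c : ¬ (ch c J ≈ c)) (cJ≉c+4 : ¬ (ch c J ≈ p6))
                       (M : Subset n) (tM : Cover M) (iM : Irredundant M) (aM : a ∈ₙ M) (toks : ∀ t → t ≤ J → ch c t ∉ₙ M) where
      open Lift M tM aM toks

      p8 : ℕ
      p8 = suc (suc p6)

      p8∈M : p8 ∈ₙ M
      p8∈M with tM p6
      ... | inj₁ x = ⊥-elim (p6∉M x)
      ... | inj₂ x = x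

      p10≡ : suc (suc p8) ≡ ch c 2
      p10≡ = l c
        where
        l : ∀ c → suc (suc (suc (suc (c + 4 * 1)))) ≡ c + 4 * 2
        l = solve-∀

      p4∉lift : p4 ∉ₙ lift M
      p4∉lift = ∉delₙ-self {add (add M c) p6} {p4}

      stays-out : ∀ {y} z → z ∉ₙ del M y → ¬ (z ≈ c) → ¬ (z ≈ p6) → z ∉ₙ del (lift M) y
      stays-out z h zc z6 with ∉del-split h
      ... | inj₂ e = ∉del-≈ e
      ... | inj₁ zM = λ h' → out-lift z zM zc z6 (proj₁ (del-inv h'))

      stays-out' : ∀ {y} z → z ∉ₙ M → ¬ (z ≈ c) → ¬ (z ≈ p6) → z ∉ₙ del (lift M) y
      stays-out' z zM zc z6 h' = out-lift z zM zc z6 (proj₁ (del-inv h'))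

      -- Deleting an old vertex y of M: M - y has an uncovered pair {i, i+2},
      -- and that pair (or a nearby one, when it meets c or a+6) stays
      -- uncovered in M⁺ - y.
      old-irredundant : ∀ y → y ∈ₙ M → ¬ (y ≈ p4) → ¬ Cover (del (lift M) y)
      old-irredundant y yM y4 with witness (del M y) (iM y yM)
      ... | i , ni , nsi with i ≈? c | i ≈? p6 | suc (suc i) ≈? c | suc (suc i) ≈? p6
      ...   | yes ic | _ | _ | _ = ⊥-elim (y4 (≈-sym yp4))
        where
        yp4 : p4 ≈ y
        yp4 with ∉del-split nsi
        ... | inj₂ e = ≈-trans (≈-sym (≈-ss ic)) e
        ... | inj₁ n4' = ⊥-elim (n4' (∈-≈ (≈-sym (≈-ss ic)) p4∈M))
      ...   | no _ | yes i6 | _ | _ =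
              notCover p8 (∉del-≈ (≈-sym yp8))
                (stays-out' (suc (suc p8)) (subst (_∉ₙ M) (sym p10≡) (toks 2 J2))
                  (λ e → c+8≉c (≈-trans (≡⇒≈ (sym p10≡)) e)) (λ e → c+8≉c+4 (≈-trans (≡⇒≈ (sym p10≡)) e)))
        where
        yp8 : y ≈ p8
        yp8 with ∉del-split nsi
        ... | inj₂ e = ≈-trans (≈-sym e) (≈-ss i6)
        ... | inj₁ n8 = ⊥-elim (n8 (∈-≈ (≈-sym (≈-ss i6)) p8∈M))
      ...   | no _ | no _ | yes sic | _ =
              notCover (ch c J) (stays-out' (ch c J) (toks J ≤-refl) cJ≉c cJ≉c+4) (∉del-≈ (≈-trans eJ (≈-sym ya)))
        where
        ia : i ≈ a
        ia = ≈-ss-cancel sic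
        ya : y ≈ a
        ya with ∉del-split ni
        ... | inj₂ e = ≈-trans (≈-sym e) ia
        ... | inj₁ na = ⊥-elim (na (∈-≈ (≈-sym ia) aM))
      ...   | no _ | no _ | no _ | yes si6 = ⊥-elim (y4 (≈-sym yp4))
        where
        ip4 : i ≈ p4
        ip4 = ≈-ss-cancel (≈-trans si6 (≡⇒≈ p6≡))
        yp4 : p4 ≈ y
        yp4 with ∉del-split ni
        ... | inj₂ e = ≈-trans (≈-sym ip4) e
        ... | inj₁ n4' = ⊥-elim (n4' (∈-≈ (≈-sym ip4) p4∈M))
      ...   | no ic | no i6 | no sic | no si6 = notCover i (stays-out i ni ic i6) (stays-out (suc (suc i)) nsi sic si6)

      -- Deleting a new vertex leaves a pair through a+4 uncovered.
      lift-irredundant : Irredundant (lift M)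
      lift-irredundant y y∈lift with fresh-lift y y∈lift
      ... | inj₂ (inj₂ y6) = notCover p4 (λ h → p4∉lift (proj₁ (del-inv h))) (∉del-≈ (≈-trans (≡⇒≈ (sym p6≡)) (≈-sym y6)))
      ... | inj₂ (inj₁ yc) = notCover c (∉del-≈ (≈-sym yc)) (λ h → p4∉lift (proj₁ (del-inv h)))
      ... | inj₁ yM = old-irredundant y yM (proj₂ (del-inv y∈lift))

    handler-allTokens : Budget → Handler a J
    handler-allTokens budget S t le aS toks with reduce B S le t (≤-trans le (≤-trans (n≤1+n B) Bk))
    ... | red with ∈ₙ? a (Reduced.M red)
    ...   | no aout = toMinimal , aout
      where
      toMinimal : Move S (OnCycle a)
      toMinimal = record { S' = Reduced.M red ; path = Reduced.path red ; tds = Reduced.coverM red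
                         ; size = ≤-trans (p⊆q⇒∣p∣≤∣q∣ (Reduced.sub red)) le
                         ; fresh = λ x h → inj₁ (Reduced.sub red h) }
    ...   | yes ain with budget M (Reduced.coverM red , Reduced.irredundantM red , ain , toksM)
      where
      M = Reduced.M red
      toksM : ∀ t → t ≤ J → ch c t ∉ₙ M
      toksM u u≤ h = toks u u≤ (Reduced.sub red h)
    ...     | bk , bB with evict a (a + 2 * hm) tds-lift (subst (_≤ B) (sym size-lift) bB) a∈lift c∈lift eL
      where open Lift (Reduced.M red) (Reduced.coverM red) ain (λ u u≤ h → toks u u≤ (Reduced.sub red h))
    ...       | r , out = weaken newOnCycle (then toLift r) , out
      where
      open Lift (Reduced.M red) (Reduced.coverM red) ain (λ u u≤ h → toks u u≤ (Reduced.sub red h))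
      toLift : Move S (λ x → x ≈ c ⊎ x ≈ p6)
      toLift = record { S' = lift (Reduced.M red) ; path = trans-R (Reduced.path red) (path-lift bk)
                      ; tds = tds-lift ; size = subst (_≤ B) (sym size-lift) bB
                      ; fresh = λ x h → [ (λ m → inj₁ (Reduced.sub red m)) , inj₂ ] (fresh-lift x h) }
      p6≡a+2*3 : ∀ a → suc (suc a) + 4 * 1 ≡ a + 2 * 3
      p6≡a+2*3 = solve-∀
      newOnCycle : ∀ x → (x ≈ c ⊎ x ≈ p6) ⊎ x ≈ a + 2 * hm → OnCycle a x
      newOnCycle x (inj₁ (inj₁ e)) = onCycle-next a x e
      newOnCycle x (inj₁ (inj₂ e)) = onCycle a 3 (≈-trans e (≡⇒≈ (p6≡a+2*3 a)))
      newOnCycle x (inj₂ e) = onCycle a hm e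

-- The canonical pattern 'isToken' makes the indices
-- 0, 2, 4, ... absent ("tokens") and all others present, except that the
-- last index m-1 is always present so that the pair {a+2(m-1), a} stays
-- covered.  Starting from a cover without a, index q+1 is fixed in turn
-- (q = 0, 1, ...) by at most one deletion or slide, never touching indices
-- ≤ q nor vertices off this cycle.
module Sweeping (n₀ k B : ℕ) (Bk : suc B ≤ k) where

  open import Data.Nat using (zero; suc; _+_; _*_; _∸_; _≤_; _<_; s≤s; z≤n; _≤ᵇ_)
  open import Data.Nat.Properties
  open import Data.Nat.Tactic.RingSolver using (solve-∀)
  open import Data.Bool using (Bool; true; false; not; _∧_; T)
  open import Data.Fin.Subset using (Subset; _⊆_; ∣_∣)
  open import Data.Product using (_×_; _,_; proj₁; proj₂; uncurry)
  open import Data.Sum using (inj₁; inj₂; [_,_])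
  open import Data.Empty using (⊥-elim) renaming (⊥ to False)
  open import Relation.Nullary using (¬_; yes; no; Dec)
  open import Relation.Binary.PropositionalEquality hiding ([_])
  open import Relation.Binary.Definitions using (tri<; tri≈; tri>)
  open Walks
  open CyclePositions n₀
  open TwoStepCovers n₀
  open Moves n₀ k
  open Chains n₀ k B Bk using (spare)

  Same : Subset n → Subset n → ℕ → Set
  Same S S' x = (x ∈ₙ S → x ∈ₙ S') × (x ∈ₙ S' → x ∈ₙ S)

  ixl : ∀ a q → suc (suc (a + 2 * q)) ≡ a + 2 * suc q
  ixl = solve-∀

  module Sweep (a m : ℕ) (wrap : a + 2 * m ≈ a)
               (inj : ∀ q q' → q < q' → q' < m → ¬ (a + 2 * q ≈ a + 2 * q')) where

    ix : ∀ q → suc (suc (a + 2 * q)) ≡ a + 2 * suc q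
    ix = ixl a

    -- The canonical pattern: true means "absent".
    isToken : ℕ → Bool
    isToken zero = true
    isToken (suc q) = not (isToken q) ∧ (3 + q ≤ᵇ m)

    Agrees : Subset n → ℕ → Set
    Agrees S q = (isToken q ≡ true → a + 2 * q ∉ₙ S) × (isToken q ≡ false → a + 2 * q ∈ₙ S)

    AgreesBelow : Subset n → ℕ → Set
    AgreesBelow S q = ∀ t → t < q → Agrees S t

    OffCycle : ℕ → Set
    OffCycle x = ∀ t → t < m → ¬ (x ≈ a + 2 * t)

    record Swept (S : Subset n) (q : ℕ) : Set where
      field
        S' : Subset n
        path : R S S'
        tds : Cover S'
        size : ∣ S' ∣ ≤ ∣ S ∣
        pre : AgreesBelow S' q
        off : ∀ x → OffCycle x → Same S S' x

    unmoved : ∀ {S q} → Cover S → AgreesBelow S q → Swept S q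
    unmoved {S} t pr = record { S' = S ; path = here ; tds = t ; size = ≤-refl ; pre = pr
                              ; off = λ _ _ → (λ h → h) , (λ h → h) }

    keepAgreement : ∀ {S S'} q → AgreesBelow S q → (∀ t → t < q → Same S S' (a + 2 * t)) → AgreesBelow S' q
    keepAgreement q pr sm t t<q = (λ e h → proj₁ (pr t t<q) e (proj₂ (sm t t<q) h))
                                , (λ e → proj₁ (sm t t<q) (proj₂ (pr t t<q) e))

    extendAgreement : ∀ {S} q → AgreesBelow S (suc q) → Agrees S (suc q) → AgreesBelow S (suc (suc q))
    extendAgreement q pr ag u u< with m≤n⇒m<n∨m≡n (≤-pred u<)
    ... | inj₁ lt = pr u lt
    ... | inj₂ refl = ag

    true≢false : ∀ {b} → b ≡ true → b ≡ false → False
    true≢false refl ()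

    -- Index q+1 must become a token while index q is present: delete
    -- a+2(q+1), first inserting a+2(q+2) if it is absent.  Only these two
    -- positions change, and they are distinct from all earlier indices and
    -- from the vertices off the cycle.
    makeToken : ∀ q {S} → suc (suc q) < m → AgreesBelow S (suc q) → a + 2 * q ∈ₙ S
              → isToken (suc q) ≡ true → Cover S → ∣ S ∣ ≤ B → Swept S (suc (suc q))
    makeToken q {S} sq<m pr pvS tkt t le = byCases (∈ₙ? p S) (∈ₙ? nx S)
      where
      p nx : ℕ
      p = a + 2 * suc q
      nx = a + 2 * suc (suc q)
      prevCovers : ∀ {T'} → S ⊆ T' → ∀ i → suc (suc i) ≈ p → i ∈ₙ T'
      prevCovers sub i e = sub (∈-≈ (≈-ss-cancel (≈-trans (≡⇒≈ (ix q)) (≈-sym e))) pvS)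
      distinct : ∀ x → (∀ t → t < m → x ≈ a + 2 * t → t ≤ q) → ¬ (x ≈ p) × ¬ (x ≈ nx)
      distinct x f = (λ e → 1+n≰n (f (suc q) (<-trans (n<1+n (suc q)) sq<m) e))
                   , (λ e → 1+n≰n (≤-trans (n≤1+n (suc q)) (f (suc (suc q)) sq<m e)))
      earlierIndex : ∀ t → t < suc q → ∀ u → u < m → a + 2 * t ≈ a + 2 * u → u ≤ q
      earlierIndex t t< u u<m e with <-cmp t u
      ... | tri< lt _ _ = ⊥-elim (inj t u lt u<m e)
      ... | tri≈ _ refl _ = ≤-pred t<
      ... | tri> _ _ gt = ≤-trans (<⇒≤ gt) (≤-pred t<)
      swept : ∀ S' → R S S' → Cover S' → ∣ S' ∣ ≤ ∣ S ∣ → p ∉ₙ S'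
            → (∀ x → ¬ (x ≈ p) → ¬ (x ≈ nx) → Same S S' x) → Swept S (suc (suc q))
      swept S' path td size p∉ same = record
        { S' = S' ; path = path ; tds = td ; size = size
        ; pre = extendAgreement q
                  (keepAgreement (suc q) pr (λ t' t'< → uncurry (same _) (distinct _ (earlierIndex t' t'<))))
                  ((λ _ → p∉) , λ e → ⊥-elim (true≢false tkt e))
        ; off = λ x o → uncurry (same x) (distinct x (λ u u<m e → ⊥-elim (o u u<m e))) }

      byCases : Dec (p ∈ₙ S) → Dec (nx ∈ₙ S) → Swept S (suc (suc q))
      byCases (no pS) _ = unmoved t (extendAgreement q pr ((λ _ → pS) , λ e → ⊥-elim (true≢false tkt e)))
      byCases (yes pS) (yes nS) = swept (del S p) (mv-del td pS (≤-trans le (≤-trans (n≤1+n B) Bk))) td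
                                    (≤-trans (n≤1+n _) (≤-reflexive (size-delₙ {S} {p} pS))) (∉delₙ-self {S} {p})
                                    (λ x np _ → (λ h → del-i h np) , (λ h → proj₁ (del-inv h)))
        where
        td : Cover (del S p)
        td = del-cover t (subst (_∈ₙ S) (sym (ix (suc q))) nS) (prevCovers (λ h → h))
      byCases (yes pS) (no nS) = swept (del (add S nx) p) (Slid.path sl) (Slid.tds sl) (≤-reflexive (Slid.size sl))
                                   (∉delₙ-self {add S nx} {p}) same
        where
        sl : Slid S nx p
        sl = mv-slide t nS pS (add-r (≡⇒≈ (ix (suc q)))) (prevCovers (add-sub {S} {nx})) (spare le)
        same : ∀ x → ¬ (x ≈ p) → ¬ (x ≈ nx) → Same S (del (add S nx) p) x
        same x np nn = (λ h → del-i (add-l h) np)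
                     , (λ h → [ (λ h → h) , (λ e → ⊥-elim (nn e)) ] (add-inv (proj₁ (del-inv h))))

    sweepStep : ∀ q {S} → suc q < m → AgreesBelow S (suc q) → Cover S → ∣ S ∣ ≤ B → Swept S (suc (suc q))
    sweepStep q {S} q<m pr t le with isToken q in e0 | (3 + q ≤ᵇ m) in eb
    -- Index q is a token, so index q+1 is present because {a+2q, a+2(q+1)} is covered.
    ... | true | _ = unmoved t (extendAgreement q pr
                      ((λ e → ⊥-elim (true≢false e (cong (λ b → not b ∧ (3 + q ≤ᵇ m)) e0))) , λ _ → present))
      where
      present : a + 2 * suc q ∈ₙ S
      present with t (a + 2 * q)
      ... | inj₁ h = ⊥-elim (proj₁ (pr q ≤-refl) e0 h)
      ... | inj₂ h = subst (_∈ₙ S) (ix q) h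
    -- Index q+1 = m-1 is the last one; it is present because a is a token.
    ... | false | false = unmoved t (extendAgreement q pr
                           ((λ e → ⊥-elim (true≢false e (cong₂ (λ b c → not b ∧ c) e0 eb))) , λ _ → present))
      where
      last : suc (suc q) ≡ m
      last = ≤-antisym q<m (≤-pred (≰⇒> (λ h → subst T eb (≤⇒≤ᵇ h))))
      a∉ : a ∉ₙ S
      a∉ h = proj₁ (pr 0 (s≤s z≤n)) refl (subst (_∈ₙ S) (sym (+-identityʳ a)) h)
      present : a + 2 * suc q ∈ₙ S
      present with t (a + 2 * suc q)
      ... | inj₁ h = h
      ... | inj₂ h = ⊥-elim (a∉ (∈-≈ wrap (subst (_∈ₙ S) (trans (ix (suc q)) (cong (λ z → a + 2 * z) last)) h)))
    ... | false | true = makeToken q (≤ᵇ⇒≤ (3 + q) m (subst T (sym eb) _)) pr (proj₂ (pr q ≤-refl) e0)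
                           (cong₂ (λ b c → not b ∧ c) e0 eb) t le

    sweepAll : ∀ d q {S} → d + suc q ≡ m → AgreesBelow S (suc q) → Cover S → ∣ S ∣ ≤ B → Swept S m
    sweepAll zero q {S} e pr t le = unmoved t (subst (AgreesBelow S) e pr)
    sweepAll (suc d) q {S} e pr t le = record
      { S' = Swept.S' r2 ; path = trans-R (Swept.path r1) (Swept.path r2)
      ; tds = Swept.tds r2 ; size = ≤-trans (Swept.size r2) (Swept.size r1) ; pre = Swept.pre r2
      ; off = λ x o → (λ h → proj₁ (Swept.off r2 x o) (proj₁ (Swept.off r1 x o) h))
                     , (λ h → proj₂ (Swept.off r1 x o) (proj₂ (Swept.off r2 x o) h)) }
      where
      q<m : suc q < m
      q<m = subst (suc q <_) e (s≤s (m≤n+m (suc q) d))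
      r1 = sweepStep q q<m pr t le
      r2 = sweepAll d (suc q) (trans (+-suc d (suc q)) e) (Swept.pre r1) (Swept.tds r1) (≤-trans (Swept.size r1) le)

    sweep : ∀ {S} → a ∉ₙ S → Cover S → ∣ S ∣ ≤ B → 1 ≤ m → Swept S m
    sweep {S} aS t le m1 = sweepAll (m ∸ 1) 0 (trans (+-comm (m ∸ 1) 1) (m+[n∸m]≡n m1)) startAgrees t le
      where
      startAgrees : AgreesBelow S 1
      startAgrees zero _ = (λ _ h → aS (subst (_∈ₙ S) (+-identityʳ a) h)) , λ ()
      startAgrees (suc t) (s≤s ())

    agreement-unique : ∀ {S S'} → AgreesBelow S m → AgreesBelow S' m → ∀ q → q < m → Same S S' (a + 2 * q)
    agreement-unique {S} {S'} p p' q q< with isToken q in e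
    ... | true = (λ h → ⊥-elim (proj₁ (p q q<) e h)) , (λ h → ⊥-elim (proj₁ (p' q q<) e h))
    ... | false = (λ _ → proj₂ (p' q q<) e) , (λ _ → proj₂ (p q q<) e)

module CycleStructure (n₀ : ℕ) where

  open import Data.Nat using (zero; suc; _+_; _*_; _∸_; _≤_; _<_; s≤s; z≤n; _%_; NonZero; >-nonZero)
  open import Data.Nat.Properties
  open import Data.Nat.DivMod
  open import Data.Nat.Divisibility using (_∣_; divides; *-cancelˡ-∣; ∣⇒≤)
  open import Data.Product using (_,_; ∃-syntax)
  open import Data.Sum using (_⊎_; inj₁; inj₂)
  open import Relation.Nullary using (¬_)
  open import Relation.Binary.PropositionalEquality
  open import Data.Nat.Tactic.RingSolver using (solve-∀)
  open CyclePositions n₀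

  even-or-odd : ∀ x → (∃[ u ] x ≡ 2 * u) ⊎ (∃[ u ] x ≡ 1 + 2 * u)
  even-or-odd zero = inj₁ (0 , refl)
  even-or-odd (suc x) with even-or-odd x
  ... | inj₁ (u , e) = inj₂ (u , cong suc e)
  ... | inj₂ (u , e) = inj₁ (suc u , trans (cong suc e) (l u))
    where
    l : ∀ u → suc (1 + 2 * u) ≡ 2 * suc u
    l = solve-∀

  even%2 : ∀ m → (2 * m) % 2 ≡ 0
  even%2 m = trans (cong (_% 2) (*-comm 2 m)) ([m+kn]%n≡m%n 0 m 2)

  odd%2 : ∀ m → (1 + 2 * m) % 2 ≡ 1
  odd%2 m = trans (cong (λ z → (1 + z) % 2) (*-comm 2 m)) ([m+kn]%n≡m%n 1 m 2)

  par : ∀ {x y} → 2 ∣ n → x ≈ y → x % 2 ≡ y % 2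
  par {x} {y} d (mk≈ e) = trans (sym (m∣n⇒o%n%m≡o%m 2 n x d)) (trans (cong (_% 2) e) (m∣n⇒o%n%m≡o%m 2 n y d))

  par-ne : ∀ u v → 2 ∣ n → ¬ (2 * u ≈ 1 + 2 * v)
  par-ne u v d e with trans (sym (even%2 u)) (trans (par d e) (odd%2 v))
  ... | ()

  diff≈ : ∀ a q q' → q < q' → a + 2 * q ≈ a + 2 * q' → n ∣ (2 * (q' ∸ q))
  diff≈ a q q' lt e = shift-≈ (a + 2 * q) (2 * (q' ∸ q)) (≈-trans (≡⇒≈ eq) (≈-sym e))
    where
    eq : a + 2 * q + 2 * (q' ∸ q) ≡ a + 2 * q'
    eq = trans (+-assoc a (2 * q) (2 * (q' ∸ q))) (cong (a +_) (trans (sym (*-distribˡ-+ 2 q (q' ∸ q))) (cong (2 *_) (m+[n∸m]≡n (<⇒≤ lt)))))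

  inj-even : ∀ h → n ≡ 2 * h → ∀ a q q' → q < q' → q' < h → ¬ (a + 2 * q ≈ a + 2 * q')
  inj-even h eqn a q q' lt lt' e = <-irrefl refl (<-≤-trans dlt hd)
    where
    d = q' ∸ q
    d>0 : 0 < d
    d>0 = m<n⇒0<n∸m lt
    instance nzd : NonZero d
    nzd = >-nonZero d>0
    dvd : 2 * h ∣ 2 * d
    dvd = subst (_∣ 2 * d) eqn (diff≈ a q q' lt e)
    hd : h ≤ d
    hd = ∣⇒≤ (*-cancelˡ-∣ 2 dvd)
    dlt : d < h
    dlt = ≤-<-trans (m∸n≤m q' q) lt'

  twice≢odd : ∀ d h → ¬ (2 * d ≡ 1 + 2 * h)
  twice≢odd d h e with trans (sym (even%2 d)) (trans (cong (_% 2) e) (odd%2 h))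
  ... | ()

  inj-odd : ∀ h → n ≡ 1 + 2 * h → ∀ a q q' → q < q' → q' < n → ¬ (a + 2 * q ≈ a + 2 * q')
  inj-odd h eqn a q q' lt lt' e with diff≈ a q q' lt e
  ... | divides zero eq = <-irrefl refl (subst (0 <_) eq (*-monoʳ-< 2 (m<n⇒0<n∸m lt)))
  ... | divides (suc zero) eq = twice≢odd (q' ∸ q) h (trans eq (trans (*-identityˡ n) eqn))
  ... | divides (suc (suc c)) eq = <-irrefl refl (≤-<-trans big small)
    where
    big : 2 * n ≤ 2 * (q' ∸ q)
    big = subst (2 * n ≤_) (sym eq) (*-monoˡ-≤ n {2} {suc (suc c)} (s≤s (s≤s z≤n)))
    small : 2 * (q' ∸ q) < 2 * n
    small = *-monoʳ-< 2 (≤-<-trans (m∸n≤m q' q) lt')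

-- Evict 0
-- (the all-token case is impossible here, the chain from 2 wraps onto 4),
-- then sweep the cycle; the canonical set is the one agreeing with the
-- pattern on the whole cycle, i.e. on every vertex.
module OddCase (n₀ k B : ℕ) (Bk : suc B ≤ k) (h : ℕ) (eqn : suc (suc (suc n₀)) ≡ 1 + 2 * h) where

  open import Data.Nat using (suc; _+_; _*_; _≤_; _<_; s≤s; s≤s⁻¹; z≤n)
  open import Data.Nat.Properties
  open import Data.Nat.Tactic.RingSolver using (solve-∀)
  open import Data.Fin using (toℕ)
  open import Data.Fin.Properties using (toℕ<n)
  open import Data.Fin.Subset using (Subset; _∈_; _⊆_; ∣_∣)
  open import Data.Fin.Subset.Properties using (⊆-antisym)
  open import Data.Product using (_×_; _,_; proj₁; proj₂; ∃-syntax; Σ)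
  open import Data.Sum using (inj₁; inj₂)
  open import Relation.Binary.PropositionalEquality
  open Walks
  open CyclePositions n₀
  open TwoStepCovers n₀
  open CycleStructure n₀
  open Moves n₀ k
  open Chains n₀ k B Bk
  open Eviction n₀ k B Bk
  open Sweeping n₀ k B Bk

  eL : suc (suc (0 + 2 * (2 * h))) ≈ 0
  eL = ≈-trans (≡⇒≈ (trans (l h) (cong (2 *_) (sym eqn)))) (≈-kn 0 2)
    where
    l : ∀ h → suc (suc (0 + 2 * (2 * h))) ≡ 2 * (1 + 2 * h)
    l = solve-∀

  handler : Handler 0 (suc h)
  handler = handler-contra 0 (suc h) wraps
    where
    wraps : ∀ c → c + 4 * suc h ≈ suc (suc c)
    wraps c = ≈-trans (≡⇒≈ (trans (l c h) (cong (λ z → suc (suc c) + 2 * z) (sym eqn)))) (≈-kn (suc (suc c)) 2)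
      where
      l : ∀ c h → c + 4 * suc h ≡ suc (suc c) + 2 * (1 + 2 * h)
      l = solve-∀

  open Sweep 0 n (≈-kn 0 2) (inj-odd h eqn 0)

  Canon : Subset n → Set
  Canon S = AgreesBelow S n

  canon : ∀ S → Cover S → ∣ S ∣ ≤ B → Σ (Subset n) λ S' → R S S' × Canon S'
  canon S t le = Swept.S' swept , trans-R (Move.path evicted) (Swept.path swept) , Swept.pre swept
    where
    evicted = proj₁ (base 0 (2 * h) (suc h) eL handler S t le)
    swept = sweep (proj₂ (base 0 (2 * h) (suc h) eL handler S t le)) (Move.tds evicted) (Move.size evicted) (s≤s z≤n)

  onTheCycle : ∀ x → x < n → ∃[ q ] (q < n × 0 + 2 * q ≈ x)
  onTheCycle x x<n with even-or-odd x
  ... | inj₁ (u , e) = u , ≤-<-trans (subst (u ≤_) (sym e) (m≤n*m u 2)) x<n , ≡⇒≈ (sym e)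
  ... | inj₂ (u , e) = u + suc h , lt , ≈-trans (≡⇒≈ eq2) (≈-n x)
    where
    u<h : u < h
    u<h = *-cancelˡ-< 2 u h (s≤s⁻¹ (subst (_< 1 + 2 * h) e (subst (x <_) eqn x<n)))
    lt : u + suc h < n
    lt = subst (u + suc h <_) (sym eqn) (s≤s (subst (_≤ 2 * h) (sym (+-suc u h))
           (subst (suc (u + h) ≤_) (l3 h) (+-monoˡ-< h u<h))))
      where
      l3 : ∀ h → h + h ≡ 2 * h
      l3 = solve-∀
    eq2 : 0 + 2 * (u + suc h) ≡ x + n
    eq2 = trans (l u h) (sym (cong₂ _+_ e eqn))
      where
      l : ∀ u h → 0 + 2 * (u + suc h) ≡ (1 + 2 * u) + (1 + 2 * h)
      l = solve-∀

  uniq : ∀ {S T} → Canon S → Canon T → S ≡ T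
  uniq cS cT = ⊆-antisym (included cS cT) (included cT cS)
    where
    included : ∀ {S T} → Canon S → Canon T → S ⊆ T
    included {S} {T} cS cT {v} vS with onTheCycle (toℕ v) (toℕ<n v)
    ... | q , q< , e = subst (_∈ T) pv (proj₁ (agreement-unique cS cT q q<) (subst (_∈ S) (sym pv) vS))
      where
      pv : pos (0 + 2 * q) ≡ v
      pv = trans (pos-≈ e) (pos-toℕ v)

-- Evict 0 and then 1 (evicting 1 only inserts odd vertices, so 0
-- stays out), sweep the even cycle, then the odd one (which does not touch
-- even vertices).  The all-token case is left to the handlers H0 and H1,
-- which depend on n mod 4.
module EvenCase (n₀ k B : ℕ) (Bk : suc B ≤ k) (h : ℕ) (eqn : suc (suc (suc n₀)) ≡ 2 * h) where

  open import Data.Nat using (suc; _+_; _*_; _∸_; _≤_; _<_; s≤s; z≤n; _≤?_)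
  open import Data.Nat.Properties
  open import Data.Nat.Divisibility using (_∣_; divides)
  open import Data.Nat.Tactic.RingSolver using (solve-∀)
  open import Data.Fin using (Fin; toℕ)
  open import Data.Fin.Properties using (toℕ<n)
  open import Data.Fin.Subset using (Subset; _∈_; _⊆_; ∣_∣)
  open import Data.Fin.Subset.Properties using (⊆-antisym)
  open import Data.Product using (_×_; _,_; proj₁; proj₂; ∃-syntax; Σ)
  open import Data.Sum using (_⊎_; inj₁; inj₂)
  open import Relation.Nullary using (yes; no)
  open import Relation.Binary.PropositionalEquality
  open Walks
  open CyclePositions n₀
  open TwoStepCovers n₀
  open CycleStructure n₀
  open Moves n₀ k
  open Chains n₀ k B Bk
  open Eviction n₀ k B Bk
  open Sweeping n₀ k B Bk

  hm : ℕ
  hm = h ∸ 1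

  h≥2 : 2 ≤ h
  h≥2 with 2 ≤? h
  ... | yes p = p
  ... | no np with subst (_≤ 2) (sym eqn) (*-monoʳ-≤ 2 (≤-pred (≰⇒> np)))
  ...   | s≤s (s≤s ())

  eLa : ∀ a → suc (suc (a + 2 * hm)) ≈ a
  eLa a = ≈-trans (≡⇒≈ e1) (≈-n a)
    where
    l : ∀ a x → suc (suc (a + 2 * x)) ≡ a + 2 * (1 + x)
    l = solve-∀
    e1 : suc (suc (a + 2 * hm)) ≡ a + n
    e1 = trans (l a hm) (cong (a +_) (trans (cong (2 *_) (m+[n∸m]≡n (≤-trans (s≤s z≤n) h≥2))) (sym eqn)))

  2∣n : 2 ∣ n
  2∣n = divides h (trans eqn (*-comm 2 h))

  wrapa : ∀ a → a + 2 * h ≈ a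
  wrapa a = ≈-trans (≡⇒≈ (cong (a +_) (sym eqn))) (≈-n a)

  module S0 = Sweep 0 h (wrapa 0) (inj-even h eqn 0)
  module S1 = Sweep 1 h (wrapa 1) (inj-even h eqn 1)

  Canon : Subset n → Set
  Canon S = S0.AgreesBelow S h × S1.AgreesBelow S h

  module _ (J : ℕ) (H0 : Handler 0 J) (H1 : Handler 1 J) where

    canon : ∀ S → Cover S → ∣ S ∣ ≤ B → Σ (Subset n) λ S' → R S S' × Canon S'
    canon S t le = S1.Swept.S' sw1
                 , trans-R (Move.path ev) (trans-R (S0.Swept.path sw0) (S1.Swept.path sw1))
                 , agrees0 , S1.Swept.pre sw1
      where
      ev0 = base 0 hm J (eLa 0) H0 S t le
      ev1 = base 1 hm J (eLa 1) H1 (Move.S' (proj₁ ev0)) (Move.tds (proj₁ ev0)) (Move.size (proj₁ ev0))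
      ev = then (proj₁ ev0) (proj₁ ev1)
      0∉ : 0 ∉ₙ Move.S' ev
      0∉ = kept-out (proj₁ ev1) 0 (proj₂ ev0) (λ (m , e) → par-ne 0 m 2∣n e)
      sw0 = S0.sweep 0∉ (Move.tds ev) (Move.size ev) (≤-trans (s≤s z≤n) h≥2)
      1∉ : 1 ∉ₙ S0.Swept.S' sw0
      1∉ h' = proj₂ ev1 (proj₂ (S0.Swept.off sw0 1 (λ t _ e → par-ne t 0 2∣n (≈-sym e))) h')
      sw1 = S1.sweep 1∉ (S0.Swept.tds sw0) (≤-trans (S0.Swept.size sw0) (Move.size ev)) (≤-trans (s≤s z≤n) h≥2)
      agrees0 : S0.AgreesBelow (S1.Swept.S' sw1) h
      agrees0 = S0.keepAgreement h (S0.Swept.pre sw0)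
                  (λ t _ → S1.Swept.off sw1 (0 + 2 * t) (λ t' _ e → par-ne t t' 2∣n e))

  onACycle : ∀ x → x < n → ∃[ q ] (q < h × ((0 + 2 * q ≈ x) ⊎ (1 + 2 * q ≈ x)))
  onACycle x x<n with even-or-odd x
  ... | inj₁ (u , e) = u , *-cancelˡ-< 2 u h (subst (_< 2 * h) e (subst (x <_) eqn x<n)) , inj₁ (≡⇒≈ (sym e))
  ... | inj₂ (u , e) = u , *-cancelˡ-< 2 u h (≤-<-trans (n≤1+n _) (subst (_< 2 * h) e (subst (x <_) eqn x<n))) , inj₂ (≡⇒≈ (sym e))

  uniq : ∀ {S T} → Canon S → Canon T → S ≡ T
  uniq cS cT = ⊆-antisym (included cS cT) (included cT cS)
    where
    onCycleOf : ∀ {S T} → Canon S → Canon T → ∀ (v : Fin n) → v ∈ S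
              → ∃[ q ] (q < h × ((0 + 2 * q ≈ toℕ v) ⊎ (1 + 2 * q ≈ toℕ v))) → v ∈ T
    onCycleOf {S} {T} cS cT v vS (q , q< , inj₁ e) =
      subst (_∈ T) pv (proj₁ (S0.agreement-unique (proj₁ cS) (proj₁ cT) q q<) (subst (_∈ S) (sym pv) vS))
      where
      pv : pos (0 + 2 * q) ≡ v
      pv = trans (pos-≈ e) (pos-toℕ v)
    onCycleOf {S} {T} cS cT v vS (q , q< , inj₂ e) =
      subst (_∈ T) pv (proj₁ (S1.agreement-unique (proj₂ cS) (proj₂ cT) q q<) (subst (_∈ S) (sym pv) vS))
      where
      pv : pos (1 + 2 * q) ≡ v
      pv = trans (pos-≈ e) (pos-toℕ v)
    included : ∀ {S T} → Canon S → Canon T → S ⊆ T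
    included cS cT {v} vS = onCycleOf cS cT v vS (onACycle (toℕ v) (toℕ<n v))

-- The budget is B = g (so k ≥ g+1 suffices)
-- except for n = 8, where the all-token case needs B = g+1 (k ≥ g+2).
module ConnectedAboveGamma where

  open import Data.Nat using (suc; _+_; _*_; _≤_; _<_; _<?_; s≤s; z≤n)
  open import Data.Nat.Properties
  open import Data.Nat.Divisibility using (∣⇒≤)
  open import Data.Nat.Tactic.RingSolver using (solve-∀)
  open import Data.Fin.Subset using (∣_∣)
  open import Data.Product using (_,_)
  open import Relation.Nullary using (¬_)
  open import Relation.Nullary.Decidable using (from-yes)
  open import Relation.Binary.PropositionalEquality hiding (J)

  GMax : ℕ → ℕ → Set
  GMax n g = ∀ M → IsMinimalTDS n M → ∣ M ∣ ≤ g

  connOdd : ∀ n₀ h → suc (suc (suc n₀)) ≡ 1 + 2 * h → ∀ g → GMax (suc (suc (suc n₀))) g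
          → ∀ k → suc g ≤ k → DConnected (suc (suc (suc n₀))) k
  connOdd n₀ h eqn g gm k gk = connected Canon uniq g canon g ≤-refl gm
    where
    open Canonical n₀ k
    open OddCase n₀ k g gk h eqn

  -- n ≡ 2 mod 4: both two-step cycles have odd length and the chains wrap.
  conn42 : ∀ n₀ r → suc (suc (suc n₀)) ≡ 2 + 4 * r → ∀ g → GMax (suc (suc (suc n₀))) g
         → ∀ k → suc g ≤ k → DConnected (suc (suc (suc n₀))) k
  conn42 n₀ r eqn g gm k gk = connected Canon uniq g (canon (suc r) (handler 0) (handler 1)) g ≤-refl gm
    where
    open CyclePositions n₀
    open Canonical n₀ k
    open Eviction n₀ k g gk
    l42 : ∀ r → 2 + 4 * r ≡ 2 * (1 + 2 * r)
    l42 = solve-∀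
    open EvenCase n₀ k g gk (1 + 2 * r) (trans eqn (l42 r))
    handler : ∀ a → Handler a (suc r)
    handler a = handler-contra a (suc r) λ c →
      ≈-trans (≡⇒≈ (trans (l c r) (cong (suc (suc c) +_) (sym eqn)))) (≈-n (suc (suc c)))
      where
      l : ∀ c r → c + 4 * suc r ≡ suc (suc c) + (2 + 4 * r)
      l = solve-∀

  -- n = 4: each two-step cycle has just two vertices.
  conn4 : ∀ g → GMax 4 g → ∀ k → suc g ≤ k → DConnected 4 k
  conn4 g gm k gk = connected Canon uniq g (canon 0 (handler 0) (handler 1)) g ≤-refl gm
    where
    open CyclePositions 1
    open Canonical 1 k
    open Eviction 1 k g gk
    open EvenCase 1 k g gk 2 refl
    handler : ∀ a → Handler a 0
    handler a = handler-four a 0 λ i e → ≈-trans (≈-sym (≈-trans (≡⇒≈ (l i)) (≈-n i))) (≈-ss e)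
      where
      l : ∀ i → suc (suc (suc (suc i))) ≡ i + 4
      l = solve-∀

  noShift : ∀ n₀ x d → 0 < d → d < suc (suc (suc n₀)) → ¬ (CyclePositions._≈_ n₀ (x + d) x)
  noShift n₀ x (suc d) _ d<n e = <-irrefl refl (≤-<-trans (∣⇒≤ (CyclePositions.shift-≈ n₀ x (suc d) e)) d<n)

  -- n = 8: the all-token case costs two units over a minimal cover.
  conn8 : ∀ g → GMax 8 g → ∀ k → suc (suc g) ≤ k → DConnected 8 k
  conn8 g gm k gk = connected Canon uniq (suc g) (canon 1 (handler 0) (handler 1)) g (n≤1+n g) gm
    where
    open TwoStepCovers 5
    open Canonical 5 k
    open AllTokens 5 k (suc g) gk
    open EvenCase 5 k (suc g) gk 4 refl
    handler : ∀ a → Eviction.Handler 5 k (suc g) gk a 1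
    handler a = AllTokenCase.handler-allTokens a 1 hm (eLa a) (s≤s z≤n) (λ x → noShift 5 x 4 (s≤s z≤n) (from-yes (4 <? 8))) budget
      where
      budget : AllTokenCase.Budget a 1 hm (eLa a) (s≤s z≤n) (λ x → noShift 5 x 4 (s≤s z≤n) (from-yes (4 <? 8)))
      budget M (tM , iM , _) = ≤-trans (s≤s (s≤s (gm M (minimal← tM iM)))) gk , s≤s (gm M (minimal← tM iM))

  -- n = 4(3+r) ≥ 12: the lifted cover is minimal, so one unit suffices.
  conn4r : ∀ n₀ r → suc (suc (suc n₀)) ≡ 4 * (3 + r) → ∀ g → GMax (suc (suc (suc n₀))) g
         → ∀ k → suc g ≤ k → DConnected (suc (suc (suc n₀))) k
  conn4r n₀ r eqn g gm k gk = connected Canon uniq g (canon J (handler 0) (handler 1)) g ≤-refl gm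
    where
    open CyclePositions n₀
    open TwoStepCovers n₀
    open Canonical n₀ k
    open Chains n₀ k g gk using (ch)
    open Eviction n₀ k g gk using (Handler)
    open AllTokens n₀ k g gk
    n≡ : n ≡ 12 + 4 * r
    n≡ = trans eqn (l r)
      where
      l : ∀ r → 4 * (3 + r) ≡ 12 + 4 * r
      l = solve-∀
    half : ∀ r → 4 * (3 + r) ≡ 2 * (2 * (3 + r))
    half = solve-∀
    open EvenCase n₀ k g gk (2 * (3 + r)) (trans eqn (half r))
    J : ℕ
    J = 2 + r
    noShiftBelow12 : ∀ x d → 0 < d → d < 12 + 4 * r → ¬ (x + d ≈ x)
    noShiftBelow12 x d 0<d d<12 = noShift n₀ x d 0<d (subst (d <_) (sym n≡) d<12)
    no4 : ∀ x → ¬ (x + 4 ≈ x)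
    no4 x = noShiftBelow12 x 4 (s≤s z≤n) (≤-trans (from-yes (4 <? 12)) (m≤m+n 12 (4 * r)))
    handler : ∀ a → Handler a J
    handler a = handler-allTokens budget
      where
      open AllTokenCase a J hm (eLa a) (s≤s z≤n) no4
      eJ : suc (suc (ch c J)) ≈ a
      eJ = ≈-trans (≡⇒≈ (trans (l a r) (cong (a +_) (sym n≡)))) (≈-n a)
        where
        l : ∀ a r → suc (suc (suc (suc a) + 4 * (2 + r))) ≡ a + (12 + 4 * r)
        l = solve-∀
      c+8≉c : ¬ (ch c 2 ≈ c)
      c+8≉c = noShiftBelow12 c 8 (s≤s z≤n) (≤-trans (from-yes (8 <? 12)) (m≤m+n 12 (4 * r)))
      c+8≉c+4 : ¬ (ch c 2 ≈ p6)
      c+8≉c+4 e = no4 (c + 4 * 1) (≈-trans (≡⇒≈ (l c)) e)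
        where
        l : ∀ c → c + 4 * 1 + 4 ≡ c + 4 * 2
        l = solve-∀
      cJ≉c : ¬ (ch c J ≈ c)
      cJ≉c = noShiftBelow12 c (4 * J) (s≤s z≤n) (subst (_< 12 + 4 * r) (sym (l r)) (+-monoˡ-< (4 * r) (from-yes (8 <? 12))))
        where
        l : ∀ r → 4 * (2 + r) ≡ 8 + 4 * r
        l = solve-∀
      cJ≉c+4 : ¬ (ch c J ≈ p6)
      cJ≉c+4 e = noShiftBelow12 (c + 4 * 1) (4 * (1 + r)) (s≤s z≤n)
                (subst (_< 12 + 4 * r) (sym (l r)) (+-monoˡ-< (4 * r) (from-yes (4 <? 12))))
                (≈-trans (≡⇒≈ (l' c r)) e)
        where
        l : ∀ r → 4 * (1 + r) ≡ 4 + 4 * r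
        l = solve-∀
        l' : ∀ c r → c + 4 * 1 + 4 * (1 + r) ≡ c + 4 * (2 + r)
        l' = solve-∀
      budget : Budget
      budget M (tM , iM , aM , toks) = ≤-trans (s≤s lifted≤g) gk , lifted≤g
        where
        open Lift M tM aM toks
        open LiftMinimal (s≤s (s≤s z≤n)) eJ c+8≉c c+8≉c+4 cJ≉c cJ≉c+4 M tM iM aM toks
        lifted≤g : suc ∣ M ∣ ≤ g
        lifted≤g = subst (_≤ g) size-lift (gm (lift M) (minimal← tds-lift lift-irredundant))

-- Γ_t(C_n) exists (a finite search) and D_{Γ_t}^t(C_n) is disconnected: a
-- minimal TDS of maximum size Γ_t is an isolated vertex of D_{Γ_t}^t (no
-- vertex can be added within the bound, none can be removed by minimality),
-- while a minimal TDS avoiding one of its vertices is another vertex.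
module UpperTotalDomination (n₀ : ℕ) where

  open import Data.Nat using (zero; suc; _≤_; s≤s; z≤n; _≟_)
  open import Data.Nat.Properties
  open import Data.Fin using (toℕ)
  open import Data.Fin.Subset
  open import Data.Fin.Subset.Properties using (anySubset?; ∣p∣≤n; ∈⊤)
  open import Data.Product using (_×_; _,_; proj₁; proj₂; ∃-syntax)
  open import Data.Sum using (inj₁; inj₂)
  open import Data.Empty using (⊥-elim)
  open import Relation.Nullary using (¬_; yes; no; Dec)
  open import Relation.Nullary.Decidable using (_×-dec_)
  open import Relation.Binary.PropositionalEquality
  open SubsetFacts
  open CyclePositions n₀
  open TwoStepCovers n₀

  belowSuc : ∀ {P : ℕ → Set} {b} → ¬ P (suc b) → ∀ g → P g → g ≤ suc b → g ≤ b
  belowSuc npb g pg le with m≤n⇒m<n∨m≡n le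
  ... | inj₁ lt = ≤-pred lt
  ... | inj₂ refl = ⊥-elim (npb pg)

  largestBelow : (P : ℕ → Set) → (∀ g → Dec (P g)) → ∀ b → (∃[ g ] (g ≤ b × P g))
               → ∃[ g ] (P g × (∀ g' → P g' → g' ≤ b → g' ≤ g))
  largestBelow P P? b w with P? b
  ... | yes pb = b , pb , λ _ _ le → le
  largestBelow P P? zero (g , z≤n , pg) | no npb = ⊥-elim (npb pg)
  largestBelow P P? (suc b) (g , g≤ , pg) | no npb with largestBelow P P? b (g , belowSuc {P} npb g pg g≤ , pg)
  ... | g₁ , pg₁ , largest = g₁ , pg₁ , λ g' pg' le → largest g' pg' (belowSuc {P} npb g' pg' le)

  minimalBelow : ∀ S → Cover S → Moves.Reduced n₀ n S
  minimalBelow S t = Moves.reduce n₀ n n S (∣p∣≤n S) t (∣p∣≤n S)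

  allBut : ∀ x → Cover (del ⊤ x)
  allBut x i with i ≈? x
  ... | yes e = inj₂ (del-i ∈⊤ (λ e' → two-steps-move i (≈-trans e' (≈-sym e))))
  ... | no ne = inj₁ (del-i ∈⊤ ne)

  HasMinimalOfSize : ℕ → Set
  HasMinimalOfSize g = ∃[ S ] (IsMinimalTDS n S × ∣ S ∣ ≡ g)

  gExists : ∃[ g ] IsUpperTotalDomination n g
  gExists = g , pg , λ T mT → largest ∣ T ∣ (T , mT , refl) (∣p∣≤n T)
    where
    red = minimalBelow ⊤ (λ i → inj₁ ∈⊤)
    M = Moves.Reduced.M red
    search = largestBelow HasMinimalOfSize (λ g → anySubset? (λ S → minimal? S ×-dec (∣ S ∣ ≟ g))) n
               (∣ M ∣ , ∣p∣≤n M , M , minimal← (Moves.Reduced.coverM red) (Moves.Reduced.irredundantM red) , refl)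
    g = proj₁ search
    pg = proj₁ (proj₂ search)
    largest = proj₂ (proj₂ search)

  isolated : ∀ {g S T} → IsMinimalTDS n S → ∣ S ∣ ≡ g → Reach n g S T → T ≡ S
  isolated mS sg here = refl
  isolated {g} {S} {U} mS sg (step r dT e) with isolated mS sg r
  ... | refl with e
  ...   | inj₁ (v , vU , eq) = ⊥-elim (1+n≰n (subst (_≤ g) (trans (cong ∣_∣ eq) (trans (size-add S v vU) (cong suc sg))) (proj₂ dT)))
  ...   | inj₂ (v , vT , eq) = ⊥-elim (proj₂ mS U (sub , v , vS , vT) (proj₁ dT))
    where
    sub : U ⊆ S
    sub h = subst (_ ∈_) (sym eq) (∈∪⁅⁆-l U h)
    vS : v ∈ S
    vS = subst (v ∈_) (sym eq) (∈∪⁅⁆-r v U)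

  nonempty : ∀ {S} → IsTDS n S → ∃[ x ] (x ∈ S)
  nonempty {S} t with t (pos 0)
  ... | u , uS , _ = u , uS

  disconnected : ∀ g → IsUpperTotalDomination n g → ¬ DConnected n g
  disconnected g ((S , mS , sg) , gmax) dc with nonempty (proj₁ mS)
  ... | x , xS = x∉M (subst (x ∈_) (sym (isolated mS sg (dc S M (proj₁ mS , ≤-reflexive sg) (cover⇒tds tdM , gmax M mM)))) xS)
    where
    red = minimalBelow (del ⊤ (toℕ x)) (allBut (toℕ x))
    M = Moves.Reduced.M red
    tdM = Moves.Reduced.coverM red
    mM : IsMinimalTDS n M
    mM = minimal← tdM (Moves.Reduced.irredundantM red)
    x∉M : x ∉ M
    x∉M h = ∉delₙ-self {⊤} {toℕ x} (Moves.Reduced.sub red (subst (_∈ M) (sym (pos-toℕ x)) h))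

  g≥1 : ∀ g → IsUpperTotalDomination n g → 1 ≤ g
  g≥1 g ((S , mS , sg) , _) with nonempty (proj₁ mS)
  ... | x , xS = subst (1 ≤_) sg (subst (1 ≤_) (size-del S x xS) (s≤s z≤n))

-- The exceptional cycle C_8, by exhaustive computation over its 256 vertex
-- subsets: Γ_t(C_8) = 4, and D_5^t(C_8) is disconnected because along its
-- walks the property "0 and 4 both belong to the set" is invariant (a
-- deletion within size 5 never destroys it), while {0,1,4,5} has it and
-- {2,3,6,7} does not.
module CycleEight where

  open import Data.Nat using (zero; suc; _≤_; _≤?_; s≤s; z≤n)
  open import Data.Nat.Properties using (≰⇒>)
  open import Data.Fin using (Fin; zero; suc)
  open import Data.Fin.Subset
  open import Data.Fin.Subset.Properties using (anySubset?; _∈?_)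
  open import Data.Fin.Properties using (any?)
  open import Data.Vec using (_∷_; [])
  open import Data.Product using (_×_; _,_; ∃-syntax; proj₁; proj₂)
  open import Data.Sum using (inj₁; inj₂)
  open import Data.Empty using (⊥-elim)
  open import Relation.Nullary using (¬_; yes; no; Dec)
  open import Relation.Nullary.Decidable using (_×-dec_; ¬?; from-no; from-yes)
  open import Relation.Binary.PropositionalEquality
  open SubsetFacts using (∈∪⁅⁆-l)
  open Walks using (endV)
  open TwoStepCovers 5

  S0 T0 : Subset 8
  S0 = inside ∷ inside ∷ outside ∷ outside ∷ inside ∷ inside ∷ outside ∷ outside ∷ []
  T0 = outside ∷ outside ∷ inside ∷ inside ∷ outside ∷ outside ∷ inside ∷ inside ∷ []

  allMin≤4 : ¬ (∃[ S ] (IsMinimalTDS 8 S × 5 ≤ ∣ S ∣))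
  allMin≤4 = from-no (anySubset? (λ S → minimal? S ×-dec (5 ≤? ∣ S ∣)))

  up8 : IsUpperTotalDomination 8 4
  up8 = (S0 , from-yes (minimal? S0) , refl) , atMost4
    where
    atMost4 : ∀ S → IsMinimalTDS 8 S → ∣ S ∣ ≤ 4
    atMost4 S mS with ∣ S ∣ ≤? 4
    ... | yes p = p
    ... | no np = ⊥-elim (allMin≤4 (S , mS , ≰⇒> np))

  four : Fin 8
  four = suc (suc (suc (suc zero)))

  HasZeroAndFour : Subset 8 → Set
  HasZeroAndFour S = zero ∈ S × four ∈ S

  hasZeroAndFour? : ∀ S → Dec (HasZeroAndFour S)
  hasZeroAndFour? S = (zero ∈? S) ×-dec (four ∈? S)

  deletionKeeps : ¬ (∃[ T ] (∃[ v ] (IsTDS 8 T × ∣ T ∪ ⁅ v ⁆ ∣ ≤ 5 × HasZeroAndFour (T ∪ ⁅ v ⁆) × ¬ HasZeroAndFour T)))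
  deletionKeeps = from-no (anySubset? (λ T → any? (λ v → tds? T ×-dec ((∣ T ∪ ⁅ v ⁆ ∣ ≤? 5) ×-dec (hasZeroAndFour? (T ∪ ⁅ v ⁆) ×-dec ¬? (hasZeroAndFour? T))))))

  invariant : ∀ {S T} → Reach 8 5 S T → IsDVertex 8 5 S → HasZeroAndFour S → HasZeroAndFour T
  invariant here d i = i
  invariant {S} (step {T = U} r dT e) d i with invariant r d i | endV r d
  ... | iU | dU with e
  ...   | inj₁ (v , _ , eq) = subst HasZeroAndFour (sym eq) (∈∪⁅⁆-l U (proj₁ iU) , ∈∪⁅⁆-l U (proj₂ iU))
  ...   | inj₂ (v , _ , eq) with hasZeroAndFour? _
  ...     | yes p = p
  ...     | no np = ⊥-elim (deletionKeeps (_ , v , proj₁ dT , subst (λ z → ∣ z ∣ ≤ 5) eq (proj₂ dU) , subst HasZeroAndFour eq iU , np))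

  notConn5 : ¬ DConnected 8 5
  notConn5 dc = from-no (hasZeroAndFour? T0) (invariant (dc S0 T0 dS dT) dS (from-yes (hasZeroAndFour? S0)))
    where
    dS : IsDVertex 8 5 S0
    dS = from-yes (tds? S0) , s≤s (s≤s (s≤s (s≤s z≤n)))
    dT : IsDVertex 8 5 T0
    dT = from-yes (tds? T0) , s≤s (s≤s (s≤s (s≤s z≤n)))

module Assembly where

  open import Data.Nat using (zero; suc; _≤_; _≤?_)
  open import Data.Nat.Properties using (≰⇒>; ≤-pred; +-comm)
  open import Data.Nat.Tactic.RingSolver using (solve-∀)
  open import Data.Product using (_,_; proj₂; ∃-syntax)
  open import Data.Sum using (_⊎_; inj₁; inj₂)
  open import Data.Empty using (⊥-elim)
  open import Relation.Nullary using (¬_; yes; no)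
  open import Relation.Binary.PropositionalEquality using (_≡_; _≢_; refl; trans; cong; subst)
  open ConnectedAboveGamma

  classify : ∀ n → (∃[ r ] n ≡ 4 * r) ⊎ (∃[ r ] n ≡ 1 + 4 * r) ⊎ (∃[ r ] n ≡ 2 + 4 * r) ⊎ (∃[ r ] n ≡ 3 + 4 * r)
  classify zero = inj₁ (0 , refl)
  classify (suc n) with classify n
  ... | inj₁ (r , e) = inj₂ (inj₁ (r , cong suc e))
  ... | inj₂ (inj₁ (r , e)) = inj₂ (inj₂ (inj₁ (r , cong suc e)))
  ... | inj₂ (inj₂ (inj₁ (r , e))) = inj₂ (inj₂ (inj₂ (r , cong suc e)))
  ... | inj₂ (inj₂ (inj₂ (r , e))) = inj₁ (suc r , trans (cong suc e) (l r))
    where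
    l : ∀ r → suc (3 + 4 * r) ≡ 4 * suc r
    l = solve-∀

  connectedAbove : ∀ n₀ → suc (suc (suc n₀)) ≢ 8 → ∀ g → GMax (suc (suc (suc n₀))) g
                 → ∀ k → suc g ≤ k → DConnected (suc (suc (suc n₀))) k
  connectedAbove n₀ n≢8 g gm k gk with classify (suc (suc (suc n₀)))
  ... | inj₂ (inj₁ (r , e)) = connOdd n₀ (2 * r) (trans e (l r)) g gm k gk
    where
    l : ∀ r → 1 + 4 * r ≡ 1 + 2 * (2 * r)
    l = solve-∀
  ... | inj₂ (inj₂ (inj₂ (r , e))) = connOdd n₀ (1 + 2 * r) (trans e (l r)) g gm k gk
    where
    l : ∀ r → 3 + 4 * r ≡ 1 + 2 * (1 + 2 * r)
    l = solve-∀
  ... | inj₂ (inj₂ (inj₁ (r , e))) = conn42 n₀ r e g gm k gk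
  ... | inj₁ (zero , ())
  ... | inj₁ (suc zero , refl) = conn4 g gm k gk
  ... | inj₁ (suc (suc zero) , e) = ⊥-elim (n≢8 e)
  ... | inj₁ (suc (suc (suc r)) , e) = conn4r n₀ r e g gm k gk

  d0-exactly : ∀ {n} d → 1 ≤ d → ¬ DConnected n d → ConnectedFrom n (suc d) → IsD0 n (suc d)
  d0-exactly {n} d 1≤d disc conn = conn , least
    where
    least : ∀ m → ConnectedFrom n m → suc d ≤ m
    least m cm with suc d ≤? m
    ... | yes p = p
    ... | no np = ⊥-elim (disc (cm d 1≤d (≤-pred (≰⇒> np))))

  d0-aboveGamma : ∀ n₀ → suc (suc (suc n₀)) ≢ 8 → ∀ g → IsUpperTotalDomination (suc (suc (suc n₀))) g
                → IsD0 (suc (suc (suc n₀))) (g + 1)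
  d0-aboveGamma n₀ n≢8 g Γ = subst (IsD0 _) (+-comm 1 g)
    (d0-exactly g (UpperTotalDomination.g≥1 n₀ g Γ) (UpperTotalDomination.disconnected n₀ g Γ)
       (λ k _ g<k → connectedAbove n₀ n≢8 g (proj₂ Γ) k g<k))


theorem3p9 : (∃[ g ] (IsUpperTotalDomination 8 g × IsD0 8 (g + 2)))
    × (∀ (n : ℕ) → 3 ≤ n → n ≢ 8 →
    ∃[ g ] (IsUpperTotalDomination n g × IsD0 n (g + 1)))
theorem3p9 = (4 , up8 , d0-exactly 5 (s≤s z≤n) notConn5 (λ k _ 6≤k → conn8 4 (proj₂ up8) k 6≤k))
           , otherCycles
  where
  open import Data.Nat using (s≤s; z≤n)
  open import Data.Product using (_,_; proj₁; proj₂)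
  open CycleEight using (up8; notConn5)
  open ConnectedAboveGamma using (conn8)
  open Assembly using (d0-exactly; d0-aboveGamma)

  otherCycles : ∀ (n : ℕ) → 3 ≤ n → n ≢ 8 → ∃[ g ] (IsUpperTotalDomination n g × IsD0 n (g + 1))
  otherCycles (suc (suc (suc n₀))) (s≤s (s≤s (s≤s z≤n))) n≢8 =
    proj₁ Γt , proj₂ Γt , d0-aboveGamma n₀ n≢8 (proj₁ Γt) (proj₂ Γt)
    where
    Γt = UpperTotalDomination.gExists n₀
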